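{- If $G$ is an embedded graph that is orientable (embedded in an orientable surface) and checkerboard colourable (faces can be 2-coloured so that faces sharing an edge get different colours), then $P(G;2)=2^{v(G)}$, where $v(G)$ is the number of vertices of $G$.
   Context: The medial graph $G_m$ of $G$ has a degree-4 vertex $v_e$ on each edge $e$ of $G$, with edges following face boundaries of $G$ (an isolated vertex contributes a vertex-free closed curve); faces of $G_m$ containing a vertex of $G$ are black, others white. At $v_e$: the white split pairs consecutive half-edges bounding white corners, the black split those bounding black corners, the crossing pairs opposite half-edges. A state $s$ chooses a vertex state at each vertex; $c(s)$ = number of resulting closed curves, $cr(s)$ = number of crossings; Penrose states have no black split; $P(G;\lambda)=\sum_{s\text{ Penrose}}(-1)^{cr(s)}\lambda^{c(s)}$. -}

module Defs where

open import Data.Nat using (ℕ; zero; suc; _+_)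
open import Data.Bool using (Bool; true; false; not; _∧_; _∨_; if_then_else_)
import Data.Bool as B
open import Data.Fin using (Fin; toℕ; _<?_)
import Data.Fin as F
open import Data.Fin.Permutation using (Permutation′; _⟨$⟩ʳ_; _⟨$⟩ˡ_)
open import Data.List using (List; []; _∷_; map; concatMap; length; filter; allFin; foldr)
open import Data.Bool.ListAction using (any; all)
open import Data.Product using (_×_; _,_; Σ)
open import Data.Product.Properties using (≡-dec)
open import Data.Integer using (ℤ; _*_; -_; 1ℤ; 0ℤ) renaming (_+_ to _+ℤ_; _^_ to _^ℤ_)
open import Relation.Binary.Definitions using (DecidableEquality)
open import Relation.Binary.PropositionalEquality using (_≡_; _≢_)
open import Relation.Nullary.Decidable using (⌊_⌋)

module Components {A : Set} (_≟_ : DecidableEquality A)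
                  (elems : List A) (adj : A → A → Bool) where

  reach : ℕ → A → A → Bool
  reach zero    x y = ⌊ x ≟ y ⌋
  reach (suc k) x y = reach k x y ∨ any (λ z → reach k x z ∧ adj z y) elems

  connected : A → A → Bool
  connected = reach (length elems)

  countReps : List A → List A → ℕ
  countReps seen []       = 0
  countReps seen (y ∷ ys) =
    (if any (λ x → connected x y) seen then 0 else 1) + countReps (y ∷ seen) ys

  components : ℕ
  components = countReps [] elems

-- Orientable embedded graphs as combinatorial maps (rotation systems)
-- together with a number of isolated vertices.
--  * darts (half-edges) : Fin nDarts
--  * α : fixed-point-free involution pairing the two darts of an edge
--  * σ : rotation (cyclic order of darts around each vertex, in the
--        orientation of the surface); vertices with ≥1 dart = σ-orbits
--  * isolated : number of isolated vertices
-- A dart d also names the corner between d and σ d at its vertex.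
-- Faces are the orbits of α ∘ σ on corners; the two sides of the edge
-- {d , α d} are the faces of the corners d and α d.

record OrientableEmbeddedGraph : Set where
  field
    nDarts   : ℕ
    isolated : ℕ
    σ        : Permutation′ nDarts
    α        : Fin nDarts → Fin nDarts
    α-invol  : ∀ d → α (α d) ≡ d
    α-fpf    : ∀ d → α d ≢ d

  Dart : Set
  Dart = Fin nDarts

  σ⁺ σ⁻ : Dart → Dart
  σ⁺ d = σ ⟨$⟩ʳ d
  σ⁻ d = σ ⟨$⟩ˡ d

  darts : List Dart
  darts = allFin nDarts

  numVertices : ℕ
  numVertices = isolated + Components.components F._≟_ darts
                  (λ x y → ⌊ y F.≟ σ⁺ x ⌋ ∨ ⌊ x F.≟ σ⁺ y ⌋)

  -- checkerboard colourable: a colouring of faces (a colour on corners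
  -- constant along face boundaries) such that the two faces on the two
  -- sides of every edge get different colours
  CheckerboardColourable : Set
  CheckerboardColourable =
    Σ (Dart → Bool) λ col →
      (∀ d → col (α (σ⁺ d)) ≡ col d) × (∀ d → col (α d) ≢ col d)

  -- Half-edges of the medial graph: (d , true) is the end
  -- at the medial vertex v_{d} of the medial edge along corner d
  -- (between d and σ d); (d , false) is the end at v_{d} of the medial
  -- edge along corner σ⁻¹ d.  Medial edge of corner d joins (d , true)
  -- and (σ d , false).
  HalfEdge : Set
  HalfEdge = Dart × Bool

  halfEdges : List HalfEdge
  halfEdges = concatMap (λ d → (d , true) ∷ (d , false) ∷ []) darts

  medialPartner : HalfEdge → HalfEdge
  medialPartner (d , true)  = (σ⁺ d , false)
  medialPartner (d , false) = (σ⁻ d , true)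

  -- A Penrose state: for each dart a Boolean, equal on both darts of an
  -- edge; true = crossing, false = white split.  (No black splits.)
  -- At v_e, e = {d , α d}:
  --   white split : (d,true)–(αd,false), (d,false)–(αd,true)
  --   crossing    : (d,true)–(αd,true),  (d,false)–(αd,false)
  --   (black split would be (d,true)–(d,false); excluded)
  statePartner : (Dart → Bool) → HalfEdge → HalfEdge
  statePartner s (d , b) = (α d , (if s d then b else not b))

  isEdgeState : (Dart → Bool) → Bool
  isEdgeState s = all (λ d → ⌊ s (α d) B.≟ s d ⌋) darts

  _≟H_ : DecidableEquality HalfEdge
  _≟H_ = ≡-dec F._≟_ B._≟_

  -- c(s): number of closed curves of the state s (including one
  -- vertex-free closed curve per isolated vertex)
  curves : (Dart → Bool) → ℕ
  curves s = isolated + Components.components _≟H_ halfEdges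
    (λ x y → ⌊ y ≟H medialPartner x ⌋ ∨ ⌊ x ≟H medialPartner y ⌋
           ∨ ⌊ y ≟H statePartner s x ⌋)

  crossings : (Dart → Bool) → ℕ
  crossings s = length (filter (λ d → F._<?_ d (α d)) (filter (λ d → s d B.≟ true) darts))

allFuns : (n : ℕ) → List (Fin n → Bool)
allFuns zero    = (λ ()) ∷ []
allFuns (suc n) = concatMap (λ f → (λ { F.zero → false ; (F.suc i) → f i })
                                 ∷ (λ { F.zero → true  ; (F.suc i) → f i }) ∷ [])
                            (allFuns n)

sumℤ : List ℤ → ℤ
sumℤ = foldr _+ℤ_ 0ℤ

penrose : OrientableEmbeddedGraph → ℤ → ℤ
penrose G λ′ = sumℤ (map (λ s → ((- 1ℤ) ^ℤ crossings s) * (λ′ ^ℤ curves s))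
                         (filter (λ s → isEdgeState s B.≟ true) (allFuns nDarts)))
  where open OrientableEmbeddedGraph G

-- Write 2^c(s) as the number of 2-colourings f of the half-edges of the medial graph that are
-- constant along the closed curves of s, and exchange the two sums:
--   P(G;2) = 2^(isolated vertices) · Σ_f Σ_{s Penrose} (-1)^cr(s) [f is constant along the curves of s].
-- For a fixed f the inner sum vanishes unless f is constant along every medial edge and differs on
-- the two half-edges at each v_e that a black split would join: if f agrees on them, switching v_e
-- between crossing and white split is a sign-reversing involution on the states compatible with f.
-- Otherwise exactly one state is compatible with f. Adding the face colour to f gives a labelling k of
-- the vertices of G, and that state crosses exactly at the edges whose ends have different labels;
-- their number has the parity of Σ_v k(v)·deg(v), which is even because corners alternate in colour
-- around every vertex. So the inner sum is 1 for these admissible f, and they correspond to the 2^v(G)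
-- vertex labellings k.

module Submission where

open import Defs
open import Algebra.Bundles using (CommutativeMonoid; CommutativeRing)
open import Data.Bool using (Bool; true; false; not; T; _∧_; _∨_; _xor_; if_then_else_)
import Data.Bool as B
import Data.Bool.Properties as B
open import Data.Bool.ListAction using (any; all)
open import Data.Empty using (⊥-elim)
open import Data.Fin using (Fin; _<?_)
import Data.Fin as F
import Data.Fin.Properties as F
open import Data.Fin.Permutation using (Permutation′; permutation; inverseˡ; inverseʳ)
open import Data.Integer using (ℤ; +_; 0ℤ; 1ℤ; -_; _*_) renaming (_+_ to _+ℤ_; _^_ to _^ℤ_)
import Data.Integer as ℤ
import Data.Integer.Properties as ℤ
open import Data.Integer.Solver using (module +-*-Solver)
open import Data.List using (List; []; _∷_; map; concatMap; concat; filter; _++_; foldr; length; tabulate)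
open import Data.List.Membership.Propositional using (_∈_; _∉_)
open import Data.List.Membership.Propositional.Properties using (∈-++⁻; ∈-allFin; ∈-concatMap⁺)
import Data.List.Relation.Unary.All as All
open import Data.List.Relation.Unary.Any using (here; there)
import Data.List.Relation.Unary.Any as Any
open import Data.List.Relation.Unary.AllPairs using ([]; _∷_)
open import Data.List.Relation.Unary.Unique.Propositional using (Unique)
open import Data.List.Relation.Unary.Unique.Propositional.Properties using (allFin⁺)
open import Data.Nat using (ℕ; zero; suc; _+_; _≤_; _^_; _∸_; z≤n; s≤s)
import Data.Nat.Properties as ℕ
open import Data.Product using (Σ; _×_; _,_; proj₁; proj₂)
open import Data.Sum using (_⊎_; inj₁; inj₂)
open import Data.Unit using (tt)
open import Data.Vec.Functional using (updateAt)
import Data.Vec.Functional as V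
open import Data.Vec.Functional.Properties using (updateAt-updates; updateAt-minimal; ∷-cong)
open import Function using (_∘_)
open import Relation.Binary.Definitions using (DecidableEquality; tri<; tri≈; tri>)
open import Relation.Binary.PropositionalEquality
open import Relation.Nullary using (¬_; yes; no; does)
open import Relation.Nullary.Decidable using (⌊_⌋; toWitness; dec-true; dec-false)
open import Relation.Unary using (Pred; Decidable)

open import Algebra.Properties.CommutativeSemigroup (CommutativeMonoid.commutativeSemigroup B.∨-commutativeMonoid)
  using () renaming (x∙yz≈y∙xz to ∨-exchange)
open import Algebra.Properties.CommutativeMonoid.Sum (CommutativeRing.+-commutativeMonoid B.xor-∧-commutativeRing)
  using () renaming (sum to ⊕; sum-cong-≗ to ⊕-cong; ∑-distrib-+ to ⊕-distrib-xor; sum-permute to ⊕-permute)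

∨-introˡ : ∀ {a} b → a ≡ true → a ∨ b ≡ true
∨-introˡ b refl = refl

∨-introʳ : ∀ a {b} → b ≡ true → a ∨ b ≡ true
∨-introʳ false e = e
∨-introʳ true  e = refl

∨-elim : ∀ a {b} → a ∨ b ≡ true → a ≡ true ⊎ b ≡ true
∨-elim true  e = inj₁ refl
∨-elim false e = inj₂ e

∧-intro : ∀ {a b} → a ≡ true → b ≡ true → a ∧ b ≡ true
∧-intro refl refl = refl

∧-elimˡ : ∀ a {b} → a ∧ b ≡ true → a ≡ true
∧-elimˡ true e = refl

∧-elimʳ : ∀ a {b} → a ∧ b ≡ true → b ≡ true
∧-elimʳ true e = e

bool-ext : ∀ {a b} → (a ≡ true → b ≡ true) → (b ≡ true → a ≡ true) → a ≡ b
bool-ext {true}          f g = sym (f refl)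
bool-ext {false} {true}  f g = g refl
bool-ext {false} {false} f g = refl

false≢true : false ≢ true
false≢true ()

≢⇒≡not : ∀ {a b : Bool} → a ≢ b → a ≡ not b
≢⇒≡not {true}  {true}  ne = ⊥-elim (ne refl)
≢⇒≡not {true}  {false} ne = refl
≢⇒≡not {false} {true}  ne = refl
≢⇒≡not {false} {false} ne = ⊥-elim (ne refl)

≟-xor : ∀ a b i → ⌊ a xor i B.≟ b xor i ⌋ ≡ ⌊ a B.≟ b ⌋
≟-xor a b false rewrite B.xor-identityʳ a | B.xor-identityʳ b = refl
≟-xor true  true  true = refl
≟-xor true  false true = refl
≟-xor false true  true = refl
≟-xor false false true = refl

xor-cancelʳ : ∀ a c → (a xor c) xor c ≡ a
xor-cancelʳ a c = trans (B.xor-assoc a c c) (trans (cong (a xor_) (B.xor-same c)) (B.xor-identityʳ a))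

≟-xor-not : ∀ x y c → ⌊ x xor c B.≟ y xor not c ⌋ ≡ x xor y
≟-xor-not true  true  true  = refl
≟-xor-not true  true  false = refl
≟-xor-not true  false true  = refl
≟-xor-not true  false false = refl
≟-xor-not false true  true  = refl
≟-xor-not false true  false = refl
≟-xor-not false false true  = refl
≟-xor-not false false false = refl

select-≟ : ∀ a a′ b →
  (if b then a else not a) ≡ (if (if ⌊ a B.≟ a′ ⌋ then b else not b) then a′ else not a′)
select-≟ true  true  true  = refl
select-≟ true  true  false = refl
select-≟ true  false true  = refl
select-≟ true  false false = refl
select-≟ false true  true  = refl
select-≟ false true  false = refl
select-≟ false false true  = refl
select-≟ false false false = refl

implies : Bool → Bool → Bool
implies a b = not a ∨ b

implies-intro : ∀ a {b} → (a ≡ true → b ≡ true) → implies a b ≡ true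
implies-intro true  h = h refl
implies-intro false h = refl

implies-elim : ∀ a {b} → implies a b ≡ true → a ≡ true → b ≡ true
implies-elim true e refl = e

module _ {A : Set} (_≟_ : DecidableEquality A) where

  ≟-refl : ∀ x → ⌊ x ≟ x ⌋ ≡ true
  ≟-refl x with x ≟ x
  ... | yes _  = refl
  ... | no x≢x = ⊥-elim (x≢x refl)

  ≟-sound : ∀ {x y} → ⌊ x ≟ y ⌋ ≡ true → x ≡ y
  ≟-sound e = toWitness (subst T (sym e) tt)

  ≟-complete : ∀ {x y} → x ≡ y → ⌊ x ≟ y ⌋ ≡ true
  ≟-complete {x} refl = ≟-refl x

  ≟-false : ∀ {x y} → x ≢ y → ⌊ x ≟ y ⌋ ≡ false
  ≟-false {x} {y} x≢y with x ≟ y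
  ... | yes x≡y = ⊥-elim (x≢y x≡y)
  ... | no _    = refl

  ≟-sym : ∀ x y → ⌊ x ≟ y ⌋ ≡ ⌊ y ≟ x ⌋
  ≟-sym x y = bool-ext (≟-complete ∘ sym ∘ ≟-sound) (≟-complete ∘ sym ∘ ≟-sound)

  ≟-involution : ∀ (π : A → A) → (∀ x → π (π x) ≡ x) → ∀ x y → ⌊ π x ≟ y ⌋ ≡ ⌊ x ≟ π y ⌋
  ≟-involution π π-invol x y = bool-ext
    (λ e → ≟-complete (trans (sym (π-invol x)) (cong π (≟-sound e))))
    (λ e → ≟-complete (trans (cong π (≟-sound e)) (π-invol y)))

module _ {A : Set} where

  any-intro : ∀ (p : A → Bool) {x} L → x ∈ L → p x ≡ true → any p L ≡ true
  any-intro p (y ∷ L) (here refl) e = ∨-introˡ _ e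
  any-intro p (y ∷ L) (there m)   e = ∨-introʳ (p y) (any-intro p L m e)

  any-elim : ∀ (p : A → Bool) L → any p L ≡ true → Σ A λ x → x ∈ L × p x ≡ true
  any-elim p (y ∷ L) e with ∨-elim (p y) e
  ... | inj₁ h = y , here refl , h
  ... | inj₂ h with any-elim p L h
  ... | x , m , px = x , there m , px

  all-intro : ∀ (p : A → Bool) L → (∀ {x} → x ∈ L → p x ≡ true) → all p L ≡ true
  all-intro p []      h = refl
  all-intro p (y ∷ L) h = ∧-intro (h (here refl)) (all-intro p L (h ∘ there))

  all-elim : ∀ (p : A → Bool) L → all p L ≡ true → ∀ {x} → x ∈ L → p x ≡ true
  all-elim p (y ∷ L) e (here refl) = ∧-elimˡ (p y) e
  all-elim p (y ∷ L) e (there m)   = all-elim p L (∧-elimʳ (p y) e) m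

  all-false : ∀ (p : A → Bool) L → all p L ≡ false → Σ A λ x → x ∈ L × p x ≡ false
  all-false p (y ∷ L) e with p y in ep
  ... | false = y , here refl , ep
  ... | true with all-false p L e
  ... | x , m , q = x , there m , q

  all-cong : ∀ (p q : A → Bool) L → (∀ x → p x ≡ q x) → all p L ≡ all q L
  all-cong p q []      e = refl
  all-cong p q (x ∷ L) e = cong₂ _∧_ (e x) (all-cong p q L e)

  ∉⇒≢ : ∀ {y z} {L : List A} → y ∉ L → z ∈ L → z ≢ y
  ∉⇒≢ y∉ z∈ refl = y∉ z∈

  unique-head : ∀ {y} {L : List A} → Unique (y ∷ L) → y ∉ L
  unique-head (y≢ ∷ _) m = All.lookup y≢ m refl

-- Sums over lists

𝟙 : Bool → ℤ
𝟙 true  = 1ℤ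
𝟙 false = 0ℤ

𝟙-∧ : ∀ a b → 𝟙 a * 𝟙 b ≡ 𝟙 (a ∧ b)
𝟙-∧ true  b = ℤ.*-identityˡ (𝟙 b)
𝟙-∧ false b = refl

one-of-two : ∀ (F : Bool → ℤ) c {v} → F c ≡ v → F (not c) ≡ 0ℤ → F false +ℤ F true ≡ v
one-of-two F true  p q = trans (cong (_+ℤ F true) q) (trans (ℤ.+-identityˡ _) p)
one-of-two F false p q = trans (cong (F false +ℤ_) q) (trans (ℤ.+-identityʳ _) p)

+-^ : ∀ a m → (+ a) ^ℤ m ≡ + (a ^ m)
+-^ a zero    = refl
+-^ a (suc m) = trans (cong (+ a *_) (+-^ a m)) (sym (ℤ.pos-* a (a ^ m)))

≡-neg⇒≡0 : ∀ {x : ℤ} → x ≡ - x → x ≡ 0ℤ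
≡-neg⇒≡0 {+ zero}   e = refl
≡-neg⇒≡0 {+ suc n}  ()
≡-neg⇒≡0 {ℤ.-[1+ n ]} ()

∑ : {X : Set} → List X → (X → ℤ) → ℤ
∑ L F = sumℤ (map F L)

syntax ∑ L (λ x → F) = ∑[ x ∈ L ] F

module _ {X : Set} where

  ∑-cong : ∀ (L : List X) {F G : X → ℤ} → (∀ x → F x ≡ G x) → ∑ L F ≡ ∑ L G
  ∑-cong []      e = refl
  ∑-cong (x ∷ L) e = cong₂ _+ℤ_ (e x) (∑-cong L e)

  ∑-cong-∈ : ∀ (L : List X) {F G : X → ℤ} → (∀ {x} → x ∈ L → F x ≡ G x) → ∑ L F ≡ ∑ L G
  ∑-cong-∈ []      e = refl
  ∑-cong-∈ (x ∷ L) e = cong₂ _+ℤ_ (e (here refl)) (∑-cong-∈ L (e ∘ there))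

  ∑-zero : ∀ (L : List X) → ∑[ x ∈ L ] 0ℤ ≡ 0ℤ
  ∑-zero []      = refl
  ∑-zero (x ∷ L) = trans (ℤ.+-identityˡ _) (∑-zero L)

  ∑-++ : ∀ (L K : List X) F → ∑ (L ++ K) F ≡ ∑ L F +ℤ ∑ K F
  ∑-++ []      K F = sym (ℤ.+-identityˡ _)
  ∑-++ (x ∷ L) K F = trans (cong (F x +ℤ_) (∑-++ L K F)) (sym (ℤ.+-assoc (F x) _ _))

  ∑-+ : ∀ (L : List X) F G → ∑[ x ∈ L ] (F x +ℤ G x) ≡ ∑ L F +ℤ ∑ L G
  ∑-+ []      F G = refl
  ∑-+ (x ∷ L) F G rewrite ∑-+ L F G =
    solve 4 (λ a b c d → (a :+ b) :+ (c :+ d) := (a :+ c) :+ (b :+ d)) refl (F x) (G x) (∑ L F) (∑ L G)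
    where open +-*-Solver

  ∑-*ˡ : ∀ (L : List X) c F → c * ∑ L F ≡ ∑[ x ∈ L ] (c * F x)
  ∑-*ˡ []      c F = ℤ.*-zeroʳ c
  ∑-*ˡ (x ∷ L) c F = trans (ℤ.*-distribˡ-+ c (F x) _) (cong (c * F x +ℤ_) (∑-*ˡ L c F))

  ∑-neg : ∀ (L : List X) F → - ∑ L F ≡ ∑[ x ∈ L ] (- F x)
  ∑-neg []      F = refl
  ∑-neg (x ∷ L) F = trans (ℤ.neg-distrib-+ (F x) _) (cong (- F x +ℤ_) (∑-neg L F))

  ∑-filter : ∀ {p} {P : Pred X p} (P? : Decidable P) L F →
             ∑ (filter P? L) F ≡ ∑[ x ∈ L ] (if does (P? x) then F x else 0ℤ)
  ∑-filter P? []      F = refl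
  ∑-filter P? (x ∷ L) F with does (P? x)
  ... | true  = cong (F x +ℤ_) (∑-filter P? L F)
  ... | false = trans (∑-filter P? L F) (sym (ℤ.+-identityˡ _))

  ∑-𝟙-∧-δ : ∀ (L : List X) b P → ∑[ x ∈ L ] 𝟙 (P x) ≡ 1ℤ → ∑[ x ∈ L ] 𝟙 (b ∧ P x) ≡ 𝟙 b
  ∑-𝟙-∧-δ L b P δ = begin
      ∑[ x ∈ L ] 𝟙 (b ∧ P x)
    ≡⟨ ∑-cong L (λ x → sym (𝟙-∧ b (P x))) ⟩
      ∑[ x ∈ L ] (𝟙 b * 𝟙 (P x))
    ≡⟨ sym (∑-*ˡ L (𝟙 b) (𝟙 ∘ P)) ⟩
      𝟙 b * ∑[ x ∈ L ] 𝟙 (P x)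
    ≡⟨ cong (𝟙 b *_) δ ⟩
      𝟙 b * 1ℤ
    ≡⟨ ℤ.*-identityʳ (𝟙 b) ⟩
      𝟙 b ∎
    where open ≡-Reasoning

module _ {X Y : Set} where

  ∑-swap : ∀ (L : List X) (K : List Y) (F : X → Y → ℤ) → ∑[ x ∈ L ] ∑ K (F x) ≡ ∑[ y ∈ K ] ∑[ x ∈ L ] F x y
  ∑-swap []      K F = sym (∑-zero K)
  ∑-swap (x ∷ L) K F = trans (cong (∑ K (F x) +ℤ_) (∑-swap L K F))
                             (sym (∑-+ K (F x) (λ y → ∑[ x ∈ L ] F x y)))

  ∑-concatMap : ∀ (h : X → List Y) L (F : Y → ℤ) → ∑ (concatMap h L) F ≡ ∑[ x ∈ L ] ∑ (h x) F
  ∑-concatMap h []      F = refl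
  ∑-concatMap h (x ∷ L) F =
    trans (∑-++ (h x) (concat (map h L)) F) (cong (∑ (h x) F +ℤ_) (∑-concatMap h L F))

-- Labellings constant on the connected components of a finite graph

module _ {A : Set} where

  countᵇ : (A → Bool) → List A → ℕ
  countᵇ p []      = 0
  countᵇ p (y ∷ L) = (if p y then 1 else 0) + countᵇ p L

  countᵇ-≤-length : ∀ p L → countᵇ p L ≤ length L
  countᵇ-≤-length p []      = z≤n
  countᵇ-≤-length p (y ∷ L) with p y
  ... | true  = s≤s (countᵇ-≤-length p L)
  ... | false = ℕ.m≤n⇒m≤1+n (countᵇ-≤-length p L)

  private
    indicator-mono : ∀ {a b : Bool} → (a ≡ true → b ≡ true) → (if a then 1 else 0) ≤ (if b then 1 else 0)
    indicator-mono {true}  h rewrite h refl = s≤s z≤n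
    indicator-mono {false} h = z≤n

  countᵇ-mono : ∀ p q L → (∀ y → p y ≡ true → q y ≡ true) → countᵇ p L ≤ countᵇ q L
  countᵇ-mono p q []      h = z≤n
  countᵇ-mono p q (y ∷ L) h = ℕ.+-mono-≤ (indicator-mono (h y)) (countᵇ-mono p q L h)

  countᵇ-mono-strict : ∀ p q L → (∀ y → p y ≡ true → q y ≡ true) →
                       ∀ {y₀} → y₀ ∈ L → q y₀ ≡ true → p y₀ ≡ false → suc (countᵇ p L) ≤ countᵇ q L
  countᵇ-mono-strict p q (y ∷ L) h (here refl) qy py rewrite qy | py = s≤s (countᵇ-mono p q L h)
  countᵇ-mono-strict p q (y ∷ L) h (there m)   qy py =
    ℕ.≤-trans (ℕ.≤-reflexive (sym (ℕ.+-suc _ (countᵇ p L))))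
              (ℕ.+-mono-≤ (indicator-mono (h y)) (countᵇ-mono-strict p q L h m qy py))

  countᵇ-pos : ∀ p L {x} → x ∈ L → p x ≡ true → 1 ≤ countᵇ p L
  countᵇ-pos p (y ∷ L) (here refl) e rewrite e = s≤s z≤n
  countᵇ-pos p (y ∷ L) (there m)   e = ℕ.≤-trans (countᵇ-pos p L m e) (ℕ.m≤n+m _ _)

module Labellings {A : Set} (_≟_ : DecidableEquality A) where

  update : (A → Bool) → A → Bool → (A → Bool)
  update g y b z = if ⌊ z ≟ y ⌋ then b else g z

  update-same : ∀ g y b → update g y b y ≡ b
  update-same g y b rewrite ≟-refl _≟_ y = refl

  update-other : ∀ g y b z → z ≢ y → update g y b z ≡ g z
  update-other g y b z z≢y rewrite ≟-false _≟_ z≢y = refl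

  labellings : (A → Bool) → List A → List (A → Bool)
  labellings g []       = g ∷ []
  labellings g (y ∷ ys) = labellings (update g y false) ys ++ labellings (update g y true) ys

  labellings-outside : ∀ g ys {f} → f ∈ labellings g ys → ∀ z → z ∉ ys → f z ≡ g z
  labellings-outside g []       (here refl) z _ = refl
  labellings-outside g (y ∷ ys) {f} m z z∉ with ∈-++⁻ (labellings (update g y false) ys) m
  ... | inj₁ m′ = trans (labellings-outside _ ys m′ z (z∉ ∘ there)) (update-other g y false z (z∉ ∘ here))
  ... | inj₂ m′ = trans (labellings-outside _ ys m′ z (z∉ ∘ there)) (update-other g y true z (z∉ ∘ here))

  agreeOn : List A → (A → Bool) → (A → Bool) → Bool
  agreeOn L k h = all (λ x → ⌊ k x B.≟ h x ⌋) L

  agreeOn-sound : ∀ L k h → agreeOn L k h ≡ true → ∀ {x} → x ∈ L → k x ≡ h x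
  agreeOn-sound L k h e m = ≟-sound B._≟_ (all-elim _ L e m)

  agreeOn-complete : ∀ L k h → (∀ x → k x ≡ h x) → agreeOn L k h ≡ true
  agreeOn-complete L k h e = all-intro _ L (λ {x} _ → ≟-complete B._≟_ (e x))

  ∑-labellings-agreeOn : ∀ g ys h → Unique ys → ∑[ k ∈ labellings g ys ] 𝟙 (agreeOn ys k h) ≡ 1ℤ
  ∑-labellings-agreeOn g []       h u = refl
  ∑-labellings-agreeOn g (y ∷ ys) h u@(_ ∷ ys-unique) = begin
      ∑ (labellings (update g y false) ys ++ labellings (update g y true) ys) (λ k → 𝟙 (agreeOn (y ∷ ys) k h))
    ≡⟨ ∑-++ (labellings (update g y false) ys) _ _ ⟩
      choice false +ℤ choice true
    ≡⟨ cong₂ _+ℤ_ (choice≡ false) (choice≡ true) ⟩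
      𝟙 ⌊ false B.≟ h y ⌋ +ℤ 𝟙 ⌊ true B.≟ h y ⌋
    ≡⟨ exactly-one (h y) ⟩
      1ℤ ∎
    where
    open ≡-Reasoning
    choice : Bool → ℤ
    choice b = ∑[ k ∈ labellings (update g y b) ys ] 𝟙 (agreeOn (y ∷ ys) k h)

    choice≡ : ∀ b → choice b ≡ 𝟙 ⌊ b B.≟ h y ⌋
    choice≡ b = trans
      (∑-cong-∈ (labellings (update g y b) ys) λ {k} m →
        cong (λ t → 𝟙 (⌊ t B.≟ h y ⌋ ∧ agreeOn ys k h)) (ky m))
      (∑-𝟙-∧-δ (labellings (update g y b) ys) ⌊ b B.≟ h y ⌋ (λ k → agreeOn ys k h)
               (∑-labellings-agreeOn (update g y b) ys h ys-unique))
      where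
      ky : ∀ {k} → k ∈ labellings (update g y b) ys → k y ≡ b
      ky m = trans (labellings-outside _ ys m y (unique-head u)) (update-same g y b)

    exactly-one : ∀ c → 𝟙 ⌊ false B.≟ c ⌋ +ℤ 𝟙 ⌊ true B.≟ c ⌋ ≡ 1ℤ
    exactly-one true  = refl
    exactly-one false = refl

module Respects {A : Set} (elems : List A) (∈-elems : ∀ x → x ∈ elems) where

  respects : (A → A → Bool) → (A → Bool) → Bool
  respects R f = all (λ x → all (λ z → implies (R x z) ⌊ f x B.≟ f z ⌋) elems) elems

  respects-sound : ∀ R f → respects R f ≡ true → ∀ x z → R x z ≡ true → f x ≡ f z
  respects-sound R f e x z r =
    ≟-sound B._≟_ (implies-elim (R x z) (all-elim _ elems (all-elim _ elems e (∈-elems x)) (∈-elems z)) r)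

  respects-cong : ∀ {R R′} f → (∀ x z → R x z ≡ R′ x z) → respects R f ≡ respects R′ f
  respects-cong f eq = all-cong _ _ elems λ x → all-cong _ _ elems λ z →
    cong (λ t → implies t ⌊ f x B.≟ f z ⌋) (eq x z)

  respects-complete : ∀ R f → (∀ x z → R x z ≡ true → f x ≡ f z) → respects R f ≡ true
  respects-complete R f h = all-intro _ elems λ {x} _ → all-intro _ elems λ {z} _ →
    implies-intro (R x z) (≟-complete B._≟_ ∘ h x z)

module ComponentCount {A : Set} (_≟_ : DecidableEquality A)
  (elems : List A) (∈-elems : ∀ x → x ∈ elems) (elems-unique : Unique elems)
  (adj : A → A → Bool) (adj-sym : ∀ x y → adj x y ≡ adj y x) where

  open Components _≟_ elems adj
  open Labellings _≟_
  open Respects elems ∈-elems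

  reach-suc : ∀ k x y → reach k x y ≡ true → reach (suc k) x y ≡ true
  reach-suc k x y = ∨-introˡ _

  reach-step : ∀ k x z y → reach k x z ≡ true → adj z y ≡ true → reach (suc k) x y ≡ true
  reach-step k x z y r a = ∨-introʳ (reach k x y) (any-intro _ elems (∈-elems z) (∧-intro r a))

  reach-last : ∀ k x y → reach (suc k) x y ≡ true →
               reach k x y ≡ true ⊎ Σ A λ z → reach k x z ≡ true × adj z y ≡ true
  reach-last k x y e with ∨-elim (reach k x y) e
  ... | inj₁ r = inj₁ r
  ... | inj₂ r with any-elim _ elems r
  ... | z , _ , rz = inj₂ (z , ∧-elimˡ _ rz , ∧-elimʳ (reach k x z) rz)

  reach-+ : ∀ k j x y → reach k x y ≡ true → reach (k + j) x y ≡ true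
  reach-+ k zero    x y r rewrite ℕ.+-identityʳ k = r
  reach-+ k (suc j) x y r rewrite ℕ.+-suc k j = reach-suc (k + j) x y (reach-+ k j x y r)

  reach-mono : ∀ {k m} x y → k ≤ m → reach k x y ≡ true → reach m x y ≡ true
  reach-mono {k} {m} x y k≤m r =
    subst (λ t → reach t x y ≡ true) (ℕ.m+[n∸m]≡n k≤m) (reach-+ k (m ∸ k) x y r)

  reach-trans : ∀ a b x y z → reach a x y ≡ true → reach b y z ≡ true → reach (a + b) x z ≡ true
  reach-trans a zero    x y z r₁ r₂ rewrite ℕ.+-identityʳ a | ≟-sound _≟_ r₂ = r₁
  reach-trans a (suc b) x y z r₁ r₂ rewrite ℕ.+-suc a b with reach-last b y z r₂
  ... | inj₁ r           = reach-suc (a + b) x z (reach-trans a b x y z r₁ r)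
  ... | inj₂ (w , r , e) = reach-step (a + b) x w z (reach-trans a b x y w r₁ r) e

  reach-sym : ∀ k x y → reach k x y ≡ true → reach k y x ≡ true
  reach-sym zero    x y r rewrite ≟-sound _≟_ r = ≟-refl _≟_ y
  reach-sym (suc k) x y r with reach-last k x y r
  ... | inj₁ r′          = reach-suc k y x (reach-sym k x y r′)
  ... | inj₂ (w , r′ , e) =
    reach-trans 1 k y w x (reach-step 0 y y w (≟-refl _≟_ y) (trans (adj-sym y w) e)) (reach-sym k x w r′)

  Saturated : A → ℕ → Set
  Saturated x k = ∀ y → reach (suc k) x y ≡ true → reach k x y ≡ true

  saturated-bound : ∀ x k → Saturated x k → ∀ m y → reach m x y ≡ true → reach k x y ≡ true
  saturated-bound x k sat zero    y r = reach-+ 0 k x y r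
  saturated-bound x k sat (suc m) y r with reach-last m x y r
  ... | inj₁ r′          = saturated-bound x k sat m y r′
  ... | inj₂ (w , r′ , e) = sat y (reach-step k x w y (saturated-bound x k sat m w r′) e)

  -- Until saturation every step reaches a new element, so saturation happens within |elems| steps.
  saturated-or-growing : ∀ x m → suc m ≤ countᵇ (reach m x) elems ⊎ Σ ℕ λ k → k ≤ m × Saturated x k
  saturated-or-growing x zero = inj₁ (countᵇ-pos (reach 0 x) elems (∈-elems x) (≟-refl _≟_ x))
  saturated-or-growing x (suc m) with saturated-or-growing x m
  ... | inj₂ (k , k≤m , sat) = inj₂ (k , ℕ.m≤n⇒m≤1+n k≤m , sat)
  ... | inj₁ grown with any (λ y → reach (suc m) x y ∧ not (reach m x y)) elems in new
  ... | true with any-elim _ elems new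
  ... | y , y∈ , e = inj₁ (ℕ.≤-trans (s≤s grown)
          (countᵇ-mono-strict (reach m x) (reach (suc m) x) elems (reach-suc m x) y∈
             (∧-elimˡ _ e) (B.not-injective {y = false} (∧-elimʳ (reach (suc m) x y) e))))
  saturated-or-growing x (suc m) | inj₁ _ | false = inj₂ (m , ℕ.n≤1+n m , saturated)
    where
    saturated : Saturated x m
    saturated y r = ≢⇒≡not λ old → false≢true (trans (sym new)
                      (any-intro _ elems (∈-elems y) (∧-intro r (cong not old))))

  reach⇒connected : ∀ m x y → reach m x y ≡ true → connected x y ≡ true
  reach⇒connected m x y r with saturated-or-growing x (length elems)
  ... | inj₂ (k , k≤L , sat) = reach-mono x y k≤L (saturated-bound x k sat m y r)
  ... | inj₁ too-many        = ⊥-elim (ℕ.<⇒≱ too-many (countᵇ-≤-length _ elems))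

  adj⇒connected : ∀ x y → adj x y ≡ true → connected x y ≡ true
  adj⇒connected x y a = reach⇒connected 1 x y (reach-step 0 x x y (≟-refl _≟_ x) a)

  connected-sym : ∀ x y → connected x y ≡ true → connected y x ≡ true
  connected-sym = reach-sym (length elems)

  connected-trans : ∀ x y z → connected x y ≡ true → connected y z ≡ true → connected x z ≡ true
  connected-trans x y z r₁ r₂ =
    reach⇒connected (length elems + length elems) x z (reach-trans (length elems) (length elems) x y z r₁ r₂)

  respects-reach : ∀ f → respects adj f ≡ true → ∀ k x z → reach k x z ≡ true → f x ≡ f z
  respects-reach f e zero    x z r = cong f (≟-sound _≟_ r)
  respects-reach f e (suc k) x z r with reach-last k x z r
  ... | inj₁ r′          = respects-reach f e k x z r′
  ... | inj₂ (w , r′ , a) = trans (respects-reach f e k x w r′) (respects-sound adj f e w z a)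

  respects-connected≡adj : ∀ f → respects connected f ≡ respects adj f
  respects-connected≡adj f = bool-ext
    (λ e → respects-complete adj f λ x z → respects-sound connected f e x z ∘ adj⇒connected x z)
    (λ e → respects-complete connected f (respects-reach f e (length elems)))

  ConstantOn : List A → (A → Bool) → Set
  ConstantOn S g = ∀ {x z} → x ∈ S → z ∈ S → connected x z ≡ true → g x ≡ g z

  count : (A → Bool) → List A → ℤ
  count g ys = ∑[ f ∈ labellings g ys ] 𝟙 (respects connected f)

  count-≡0 : ∀ S ys g → (∀ {y} → y ∈ ys → y ∉ S) → ¬ ConstantOn S g → count g ys ≡ 0ℤ
  count-≡0 S ys g disjoint ¬const = trans (∑-cong-∈ (labellings g ys) vanishes) (∑-zero (labellings g ys))
    where
    vanishes : ∀ {f} → f ∈ labellings g ys → 𝟙 (respects connected f) ≡ 0ℤ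
    vanishes {f} f∈ with respects connected f in resp
    ... | false = refl
    ... | true  = ⊥-elim (¬const λ {x} {z} x∈ z∈ c →
      trans (sym (labellings-outside g ys f∈ x (λ x∈ys → disjoint x∈ys x∈)))
            (trans (respects-sound connected f resp x z c)
                   (labellings-outside g ys f∈ z (λ z∈ys → disjoint z∈ys z∈))))

  constantOn-∷ : ∀ S g y b → y ∉ S → ConstantOn S g →
                 (∀ {x} → x ∈ S → connected x y ≡ true → g x ≡ b) → ConstantOn (y ∷ S) (update g y b)
  constantOn-∷ S g y b y∉S const toY (here refl) (here refl) c = refl
  constantOn-∷ S g y b y∉S const toY (here refl) (there z∈)  c =
    trans (update-same g y b)
          (trans (sym (toY z∈ (connected-sym y _ c))) (sym (update-other g y b _ (∉⇒≢ y∉S z∈))))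
  constantOn-∷ S g y b y∉S const toY (there x∈)  (here refl) c =
    trans (update-other g y b _ (∉⇒≢ y∉S x∈)) (trans (toY x∈ c) (sym (update-same g y b)))
  constantOn-∷ S g y b y∉S const toY (there x∈)  (there z∈)  c =
    trans (update-other g y b _ (∉⇒≢ y∉S x∈))
          (trans (const x∈ z∈ c) (sym (update-other g y b _ (∉⇒≢ y∉S z∈))))

  constantOn-∷-unconnected : ∀ S g y → y ∉ S → ConstantOn S g → any (λ x → connected x y) S ≡ false →
                             ∀ b → ConstantOn (y ∷ S) (update g y b)
  constantOn-∷-unconnected S g y y∉S const unconnected b = constantOn-∷ S g y b y∉S const λ x∈ c →
    ⊥-elim (false≢true (trans (sym unconnected) (any-intro _ S x∈ c)))

  constantOn-∷-connected : ∀ S g y {x₀} → y ∉ S → ConstantOn S g → x₀ ∈ S → connected x₀ y ≡ true →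
    ConstantOn (y ∷ S) (update g y (g x₀)) × ¬ ConstantOn (y ∷ S) (update g y (not (g x₀)))
  constantOn-∷-connected S g y {x₀} y∉S const x₀∈ c₀ =
    constantOn-∷ S g y (g x₀) y∉S const
      (λ x∈ c → const x∈ x₀∈ (connected-trans _ y x₀ c (connected-sym x₀ y c₀))) ,
    λ const′ → B.not-¬ refl (begin
      g x₀                             ≡⟨ sym (update-other g y _ x₀ (∉⇒≢ y∉S x₀∈)) ⟩
      update g y (not (g x₀)) x₀       ≡⟨ const′ (there x₀∈) (here refl) c₀ ⟩
      update g y (not (g x₀)) y        ≡⟨ update-same g y _ ⟩
      not (g x₀)                       ∎)
    where open ≡-Reasoning

  -- S: the elements already processed by countReps, on which g is fixed; ys: the remaining ones.
  count≡2^countReps : ∀ S ys g → Unique ys → (∀ {y} → y ∈ ys → y ∉ S) → (∀ x → x ∈ S ⊎ x ∈ ys) →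
                      ConstantOn S g → count g ys ≡ + (2 ^ countReps S ys)
  count≡2^countReps S [] g _ _ cover const with respects connected g in resp
  ... | true  = refl
  ... | false = ⊥-elim (false≢true (trans (sym resp)
                  (respects-complete connected g λ x z → const (inS x) (inS z))))
    where
    inS : ∀ x → x ∈ S
    inS x with cover x
    ... | inj₁ x∈S = x∈S
  count≡2^countReps S (y ∷ ys) g u@(_ ∷ ys-unique) disjoint cover const =
    trans (∑-++ (labellings (update g y false) ys) _ _) (split (any (λ x → connected x y) S) refl)
    where
    y∉S : y ∉ S
    y∉S = disjoint (here refl)

    disjoint′ : ∀ {z} → z ∈ ys → z ∉ y ∷ S
    disjoint′ z∈ (here refl) = unique-head u z∈
    disjoint′ z∈ (there z∈S) = disjoint (there z∈) z∈S

    cover′ : ∀ x → x ∈ y ∷ S ⊎ x ∈ ys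
    cover′ x with cover x
    ... | inj₁ x∈S         = inj₁ (there x∈S)
    ... | inj₂ (here x≡y)  = inj₁ (here x≡y)
    ... | inj₂ (there x∈)  = inj₂ x∈

    r : ℕ
    r = countReps (y ∷ S) ys

    recurse : ∀ b → ConstantOn (y ∷ S) (update g y b) → count (update g y b) ys ≡ + (2 ^ r)
    recurse b = count≡2^countReps (y ∷ S) ys (update g y b) ys-unique disjoint′ cover′

    split : ∀ t → any (λ x → connected x y) S ≡ t →
            count (update g y false) ys +ℤ count (update g y true) ys ≡ + (2 ^ ((if t then 0 else 1) + r))
    split false unconnected = trans
      (cong₂ _+ℤ_ (recurse false (constantOn-∷-unconnected S g y y∉S const unconnected false))
                  (recurse true  (constantOn-∷-unconnected S g y y∉S const unconnected true)))
      (cong (λ t → + (2 ^ r + t)) (sym (ℕ.+-identityʳ (2 ^ r))))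
    split true joins with any-elim _ S joins
    ... | x₀ , x₀∈ , c₀ with constantOn-∷-connected S g y y∉S const x₀∈ c₀
    ... | same , ¬other = one-of-two (λ b → count (update g y b) ys) (g x₀)
                            (recurse (g x₀) same) (count-≡0 (y ∷ S) ys _ disjoint′ ¬other)

  ∑-respects≡2^components :
    ∑[ f ∈ labellings (λ _ → false) elems ] 𝟙 (respects adj f) ≡ + (2 ^ components)
  ∑-respects≡2^components = trans
    (∑-cong (labellings (λ _ → false) elems) (λ f → cong 𝟙 (sym (respects-connected≡adj f))))
    (count≡2^countReps [] elems (λ _ → false) elems-unique (λ _ ()) (inj₂ ∘ ∈-elems) (λ ()))

-- Sums over all Boolean functions on Fin n

updateAt-≗ : ∀ {n} {A : Set} (i : Fin n) (φ : A → A) {s s′ : Fin n → A} →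
             s ≗ s′ → updateAt s i φ ≗ updateAt s′ i φ
updateAt-≗ F.zero    φ eq F.zero    = cong φ (eq F.zero)
updateAt-≗ F.zero    φ eq (F.suc j) = eq (F.suc j)
updateAt-≗ (F.suc i) φ eq F.zero    = eq F.zero
updateAt-≗ (F.suc i) φ eq (F.suc j) = updateAt-≗ i φ (eq ∘ F.suc) j

updateAt-not : ∀ {n} (s : Fin n → Bool) i j → updateAt s i not j ≡ s j xor ⌊ j F.≟ i ⌋
updateAt-not s i j with j F.≟ i
... | yes refl = trans (updateAt-updates i s) (trans (sym (B.true-xor (s i))) (B.xor-comm true (s i)))
... | no j≢i   = trans (updateAt-minimal j i s j≢i) (sym (B.xor-identityʳ (s j)))

Extensional : ∀ {n} → ((Fin n → Bool) → ℤ) → Set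
Extensional F = ∀ {s s′} → s ≗ s′ → F s ≡ F s′

∑-allFuns-suc : ∀ n F → Extensional F →
                ∑ (allFuns (suc n)) F ≡ ∑[ f ∈ allFuns n ] (F (false V.∷ f) +ℤ F (true V.∷ f))
∑-allFuns-suc n F ext = trans (∑-concatMap _ (allFuns n) F) (∑-cong (allFuns n) λ f →
  cong₂ _+ℤ_ (ext (∷-cong refl (λ _ → refl)))
             (trans (ℤ.+-identityʳ _) (ext (∷-cong refl (λ _ → refl)))))

∑-allFuns-updateAt : ∀ n (i : Fin n) F → Extensional F →
                     ∑ (allFuns n) F ≡ ∑[ s ∈ allFuns n ] F (updateAt s i not)
∑-allFuns-updateAt (suc n) i F ext = begin
    ∑ (allFuns (suc n)) F
  ≡⟨ ∑-allFuns-suc n F ext ⟩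
    ∑[ f ∈ allFuns n ] (F (false V.∷ f) +ℤ F (true V.∷ f))
  ≡⟨ step i ⟩
    ∑[ f ∈ allFuns n ] (F (updateAt (false V.∷ f) i not) +ℤ F (updateAt (true V.∷ f) i not))
  ≡⟨ sym (∑-allFuns-suc n (λ s → F (updateAt s i not)) (ext ∘ updateAt-≗ i not)) ⟩
    ∑[ s ∈ allFuns (suc n) ] F (updateAt s i not) ∎
  where
  open ≡-Reasoning
  step : ∀ i → ∑[ f ∈ allFuns n ] (F (false V.∷ f) +ℤ F (true V.∷ f))
             ≡ ∑[ f ∈ allFuns n ] (F (updateAt (false V.∷ f) i not) +ℤ F (updateAt (true V.∷ f) i not))
  step F.zero = ∑-cong (allFuns n) λ f →
    trans (ℤ.+-comm (F (false V.∷ f)) (F (true V.∷ f))) (cong₂ _+ℤ_ (ext (∷-cong refl (λ _ → refl)))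
                                     (ext (∷-cong refl (λ _ → refl))))
  step (F.suc i) = trans
    (∑-allFuns-updateAt n i (λ f → F (false V.∷ f) +ℤ F (true V.∷ f))
                        (λ eq → cong₂ _+ℤ_ (ext (∷-cong refl eq)) (ext (∷-cong refl eq))))
    (∑-cong (allFuns n) λ f → cong₂ _+ℤ_ (ext (∷-updateAt f)) (ext (∷-updateAt f)))
    where
    ∷-updateAt : ∀ {b} f → (b V.∷ updateAt f i not) ≗ updateAt (b V.∷ f) (F.suc i) not
    ∷-updateAt f F.zero    = refl
    ∷-updateAt f (F.suc j) = refl

_≗ᵇ_ : ∀ {n} → (Fin n → Bool) → (Fin n → Bool) → Bool
_≗ᵇ_ {zero}  s h = true
_≗ᵇ_ {suc n} s h = ⌊ s F.zero B.≟ h F.zero ⌋ ∧ (V.tail s ≗ᵇ V.tail h)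

≗ᵇ-sound : ∀ {n} (s h : Fin n → Bool) → s ≗ᵇ h ≡ true → s ≗ h
≗ᵇ-sound {suc n} s h e F.zero    = ≟-sound B._≟_ (∧-elimˡ _ e)
≗ᵇ-sound {suc n} s h e (F.suc i) = ≗ᵇ-sound (V.tail s) (V.tail h) (∧-elimʳ ⌊ s F.zero B.≟ h F.zero ⌋ e) i

≗ᵇ-complete : ∀ {n} (s h : Fin n → Bool) → s ≗ h → s ≗ᵇ h ≡ true
≗ᵇ-complete {zero}  s h eq = refl
≗ᵇ-complete {suc n} s h eq =
  ∧-intro (≟-complete B._≟_ (eq F.zero)) (≗ᵇ-complete (V.tail s) (V.tail h) (eq ∘ F.suc))

≗ᵇ-cong : ∀ {n} {s s′ : Fin n → Bool} h → s ≗ s′ → s ≗ᵇ h ≡ s′ ≗ᵇ h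
≗ᵇ-cong {zero}  h eq = refl
≗ᵇ-cong {suc n} h eq =
  cong₂ _∧_ (cong (λ t → ⌊ t B.≟ h F.zero ⌋) (eq F.zero)) (≗ᵇ-cong (V.tail h) (eq ∘ F.suc))

∑-allFuns-δ : ∀ n h W → Extensional W → ∑[ s ∈ allFuns n ] (𝟙 (s ≗ᵇ h) * W s) ≡ W h
∑-allFuns-δ zero    h W ext = trans (ℤ.+-identityʳ _) (trans (ℤ.*-identityˡ _) (ext (λ ())))
∑-allFuns-δ (suc n) h W ext = begin
    ∑[ s ∈ allFuns (suc n) ] (𝟙 (s ≗ᵇ h) * W s)
  ≡⟨ ∑-allFuns-suc n _ (λ eq → cong₂ _*_ (cong 𝟙 (≗ᵇ-cong h eq)) (ext eq)) ⟩
    ∑[ f ∈ allFuns n ] (𝟙 ((false V.∷ f) ≗ᵇ h) * W (false V.∷ f) +ℤ 𝟙 ((true V.∷ f) ≗ᵇ h) * W (true V.∷ f))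
  ≡⟨ ∑-cong (allFuns n) (λ f → select (h F.zero) (f ≗ᵇ V.tail h) (λ b → W (b V.∷ f))) ⟩
    ∑[ f ∈ allFuns n ] (𝟙 (f ≗ᵇ V.tail h) * W (h F.zero V.∷ f))
  ≡⟨ ∑-allFuns-δ n (V.tail h) (λ f → W (h F.zero V.∷ f)) (λ eq → ext (∷-cong refl eq)) ⟩
    W (h F.zero V.∷ V.tail h)
  ≡⟨ ext (∷-cong refl (λ _ → refl)) ⟩
    W h ∎
  where
  open ≡-Reasoning
  select : ∀ c q (w : Bool → ℤ) →
           𝟙 (⌊ false B.≟ c ⌋ ∧ q) * w false +ℤ 𝟙 (⌊ true B.≟ c ⌋ ∧ q) * w true ≡ 𝟙 q * w c
  select true  q w = one-of-two (λ b → 𝟙 (⌊ b B.≟ true ⌋ ∧ q) * w b) true refl (ℤ.*-zeroˡ (w false))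
  select false q w = one-of-two (λ b → 𝟙 (⌊ b B.≟ false ⌋ ∧ q) * w b) false refl (ℤ.*-zeroˡ (w true))

sign : Bool → ℤ
sign false = 1ℤ
sign true  = - 1ℤ

does-≟-true : ∀ b → does (b B.≟ true) ≡ b
does-≟-true true  = refl
does-≟-true false = refl

sign-not : ∀ a → sign (not a) ≡ - sign a
sign-not true  = refl
sign-not false = refl

-1^length-filter : ∀ {A : Set} {p q} {P : Pred A p} {Q : Pred A q} (P? : Decidable P) (Q? : Decidable Q) L →
  (- 1ℤ) ^ℤ length (filter P? (filter Q? L)) ≡
  sign (foldr (λ x b → (does (Q? x) ∧ does (P? x)) xor b) false L)
-1^length-filter P? Q? [] = refl
-1^length-filter P? Q? (x ∷ L) with does (Q? x)
... | false = -1^length-filter P? Q? L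
... | true with does (P? x)
... | false = -1^length-filter P? Q? L
... | true  = trans (cong (- 1ℤ *_) (-1^length-filter P? Q? L))
                    (trans (ℤ.-1*i≡-i _) (sym (sign-not (foldr _ false L))))

foldr-xor-tabulate : ∀ n {A : Set} (f : Fin n → A) (e : A → Bool) →
                     foldr (λ x b → e x xor b) false (tabulate f) ≡ ⊕ (e ∘ f)
foldr-xor-tabulate zero    f e = refl
foldr-xor-tabulate (suc n) f e = cong (e (f F.zero) xor_) (foldr-xor-tabulate n (f ∘ F.suc) e)

⊕-flip : ∀ n (m : Fin n) (e e′ : Fin n → Bool) → (∀ j → j ≢ m → e′ j ≡ e j) → e′ m ≡ not (e m) →
         ⊕ e′ ≡ not (⊕ e)
⊕-flip (suc n) F.zero e e′ same flipped
  rewrite flipped | ⊕-cong {n} {e′ ∘ F.suc} {e ∘ F.suc} (λ j → same (F.suc j) λ ()) =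
  sym (B.not-distribˡ-xor (e F.zero) _)
⊕-flip (suc n) (F.suc m) e e′ same flipped
  rewrite same F.zero (λ ())
        | ⊕-flip n m (e ∘ F.suc) (e′ ∘ F.suc) (λ j j≢m → same (F.suc j) (j≢m ∘ F.suc-injective)) flipped =
  sym (B.not-distribʳ-xor (e F.zero) _)

-- Penrose states and labellings of the medial graph

module PenroseAtTwo (G : OrientableEmbeddedGraph) where

  open OrientableEmbeddedGraph G

  σ⁺-σ⁻ : ∀ d → σ⁺ (σ⁻ d) ≡ d
  σ⁺-σ⁻ d = inverseʳ σ

  σ⁻-σ⁺ : ∀ d → σ⁻ (σ⁺ d) ≡ d
  σ⁻-σ⁺ d = inverseˡ σ

  α-permutation : Permutation′ nDarts
  α-permutation = permutation α α α-invol α-invol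

  ∈-darts : ∀ d → d ∈ darts
  ∈-darts = ∈-allFin

  ∈-halfEdges : ∀ h → h ∈ halfEdges
  ∈-halfEdges (d , b) = ∈-concatMap⁺ _ (Any.map (λ { refl → at b }) (∈-darts d))
    where
    at : ∀ b → (d , b) ∈ (d , true) ∷ (d , false) ∷ []
    at true  = here refl
    at false = there (here refl)

  halfEdges-unique : Unique halfEdges
  halfEdges-unique = go darts (allFin⁺ nDarts)
    where
    ends : Dart → List HalfEdge
    ends d = (d , true) ∷ (d , false) ∷ []
    dart-∈ : ∀ {d b} L → (d , b) ∈ concatMap ends L → d ∈ L
    dart-∈ (x ∷ L) (here refl)         = here refl
    dart-∈ (x ∷ L) (there (here refl)) = here refl
    dart-∈ (x ∷ L) (there (there m))   = there (dart-∈ L m)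
    go : ∀ L → Unique L → Unique (concatMap ends L)
    go []      []          = []
    go (x ∷ L) (x∉ ∷ L-unique) = ((λ ()) All.∷ away true) ∷ away false ∷ go L L-unique
      where
      away : ∀ b → All.All ((x , b) ≢_) (concatMap ends L)
      away b = All.tabulate λ { m refl → All.lookup x∉ (dart-∈ L m) refl }

  isEdgeState-sound : ∀ s → isEdgeState s ≡ true → ∀ d → s (α d) ≡ s d
  isEdgeState-sound s e d = ≟-sound B._≟_ (all-elim _ darts e (∈-darts d))

  isEdgeState-complete : ∀ s → (∀ d → s (α d) ≡ s d) → isEdgeState s ≡ true
  isEdgeState-complete s h = all-intro _ darts (λ {d} _ → ≟-complete B._≟_ (h d))

  statePartner-invol : ∀ s → isEdgeState s ≡ true → ∀ h → statePartner s (statePartner s h) ≡ h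
  statePartner-invol s e (d , b) rewrite α-invol d | isEdgeState-sound s e d with s d
  ... | true  = refl
  ... | false = cong (d ,_) (B.not-involutive b)

  curveAdj : (Dart → Bool) → HalfEdge → HalfEdge → Bool
  curveAdj s x y = ⌊ y ≟H medialPartner x ⌋ ∨ ⌊ x ≟H medialPartner y ⌋ ∨ ⌊ y ≟H statePartner s x ⌋

  curveAdj-sym : ∀ s → isEdgeState s ≡ true → ∀ x y → curveAdj s x y ≡ curveAdj s y x
  curveAdj-sym s e x y = trans (∨-exchange ⌊ y ≟H medialPartner x ⌋ ⌊ x ≟H medialPartner y ⌋ _)
    (cong (⌊ x ≟H medialPartner y ⌋ ∨_) (cong (⌊ y ≟H medialPartner x ⌋ ∨_)
      (trans (≟-sym _≟H_ y (statePartner s x))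
             (≟-involution _≟H_ (statePartner s) (statePartner-invol s e) x y))))

  curveComponents : (Dart → Bool) → ℕ
  curveComponents s = Components.components _≟H_ halfEdges (curveAdj s)

  rotationAdj : Dart → Dart → Bool
  rotationAdj x y = ⌊ y F.≟ σ⁺ x ⌋ ∨ ⌊ x F.≟ σ⁺ y ⌋

  module Vertices = ComponentCount F._≟_ darts ∈-darts (allFin⁺ nDarts)
                                   rotationAdj (λ x y → B.∨-comm ⌊ y F.≟ σ⁺ x ⌋ _)
  module Curves (s : Dart → Bool) (e : isEdgeState s ≡ true) =
    ComponentCount _≟H_ halfEdges ∈-halfEdges halfEdges-unique (curveAdj s) (curveAdj-sym s e)
  open Respects darts ∈-darts using () renaming (respects to respectsᴰ; respects-sound to respectsᴰ-sound;
                                                respects-complete to respectsᴰ-complete)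
  open Respects halfEdges ∈-halfEdges

  respects-rotation-sound : ∀ k → respectsᴰ rotationAdj k ≡ true → ∀ d → k (σ⁺ d) ≡ k d
  respects-rotation-sound k e d =
    sym (respectsᴰ-sound rotationAdj k e d (σ⁺ d) (∨-introˡ _ (≟-refl F._≟_ (σ⁺ d))))

  respects-rotation-complete : ∀ k → (∀ d → k (σ⁺ d) ≡ k d) → respectsᴰ rotationAdj k ≡ true
  respects-rotation-complete k h =
    respectsᴰ-complete rotationAdj k λ x z a → along x z (∨-elim ⌊ z F.≟ σ⁺ x ⌋ a)
    where
    along : ∀ x z → ⌊ z F.≟ σ⁺ x ⌋ ≡ true ⊎ ⌊ x F.≟ σ⁺ z ⌋ ≡ true → k x ≡ k z
    along x z (inj₁ e) rewrite ≟-sound F._≟_ e = sym (h x)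
    along x z (inj₂ e) rewrite ≟-sound F._≟_ e = h z

  ConstantAlong : (Dart → Bool) → (HalfEdge → Bool) → Set
  ConstantAlong s f = ∀ h → f h ≡ f (medialPartner h) × f h ≡ f (statePartner s h)

  compatible : (Dart → Bool) → (HalfEdge → Bool) → Bool
  compatible s = respects (curveAdj s)

  compatible-sound : ∀ s f → compatible s f ≡ true → ConstantAlong s f
  compatible-sound s f e h =
    along (medialPartner h) (∨-introˡ _ (≟-refl _≟H_ (medialPartner h))) ,
    along (statePartner s h) (∨-introʳ ⌊ statePartner s h ≟H medialPartner h ⌋
                               (∨-introʳ _ (≟-refl _≟H_ (statePartner s h))))
    where
    along : ∀ z → curveAdj s h z ≡ true → f h ≡ f z
    along = respects-sound (curveAdj s) f e h

  compatible-complete : ∀ s f → ConstantAlong s f → compatible s f ≡ true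
  compatible-complete s f const =
    respects-complete (curveAdj s) f λ x z a → along x z (∨-elim ⌊ z ≟H medialPartner x ⌋ a)
    where
    along : ∀ x z →
      ⌊ z ≟H medialPartner x ⌋ ≡ true ⊎ (⌊ x ≟H medialPartner z ⌋ ∨ ⌊ z ≟H statePartner s x ⌋) ≡ true → f x ≡ f z
    along x z (inj₁ e) rewrite ≟-sound _≟H_ e = proj₁ (const x)
    along x z (inj₂ e) with ∨-elim ⌊ x ≟H medialPartner z ⌋ e
    ... | inj₁ e′ rewrite ≟-sound _≟H_ e′ = sym (proj₁ (const z))
    ... | inj₂ e′ rewrite ≟-sound _≟H_ e′ = proj₂ (const x)

  crossingSign : (Dart → Bool) → ℤ
  crossingSign s = (- 1ℤ) ^ℤ crossings s

  summand : (Dart → Bool) → (HalfEdge → Bool) → ℤ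
  summand s f = if isEdgeState s then crossingSign s * 𝟙 (compatible s f) else 0ℤ

  summand-edgeState : ∀ s f → isEdgeState s ≡ true → summand s f ≡ crossingSign s * 𝟙 (compatible s f)
  summand-edgeState s f e = cong (λ t → if t then crossingSign s * 𝟙 (compatible s f) else 0ℤ) e

  summand-nonEdgeState : ∀ s f → isEdgeState s ≡ false → summand s f ≡ 0ℤ
  summand-nonEdgeState s f e = cong (λ t → if t then crossingSign s * 𝟙 (compatible s f) else 0ℤ) e

  summand-incompatible : ∀ s f → ¬ ConstantAlong s f → summand s f ≡ 0ℤ
  summand-incompatible s f ¬const with isEdgeState s | compatible s f in c
  ... | false | _     = refl
  ... | true  | false = ℤ.*-zeroʳ (crossingSign s)
  ... | true  | true  = ⊥-elim (¬const (compatible-sound s f c))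

  allLabellings : List (HalfEdge → Bool)
  allLabellings = Labellings.labellings _≟H_ (λ _ → false) halfEdges

  weight : (Dart → Bool) → ℤ
  weight s = crossingSign s * (+ 2) ^ℤ curves s

  weight-edgeState : ∀ s → isEdgeState s ≡ true →
                     weight s ≡ (+ 2) ^ℤ isolated * ∑[ f ∈ allLabellings ] summand s f
  weight-edgeState s e = begin
      crossingSign s * (+ 2) ^ℤ (isolated + curveComponents s)
    ≡⟨ cong (crossingSign s *_) (ℤ.^-distribˡ-+-* (+ 2) isolated (curveComponents s)) ⟩
      crossingSign s * ((+ 2) ^ℤ isolated * (+ 2) ^ℤ curveComponents s)
    ≡⟨ cong (λ t → crossingSign s * ((+ 2) ^ℤ isolated * t))
            (trans (+-^ 2 (curveComponents s)) (sym (Curves.∑-respects≡2^components s e))) ⟩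
      crossingSign s * ((+ 2) ^ℤ isolated * ∑[ f ∈ allLabellings ] 𝟙 (compatible s f))
    ≡⟨ solve 3 (λ a b c → a :* (b :* c) := b :* (a :* c)) refl (crossingSign s) ((+ 2) ^ℤ isolated) _ ⟩
      (+ 2) ^ℤ isolated * (crossingSign s * ∑[ f ∈ allLabellings ] 𝟙 (compatible s f))
    ≡⟨ cong ((+ 2) ^ℤ isolated *_) (trans (∑-*ˡ allLabellings (crossingSign s) _)
                                          (∑-cong allLabellings λ f → sym (summand-edgeState s f e))) ⟩
      (+ 2) ^ℤ isolated * ∑[ f ∈ allLabellings ] summand s f ∎
    where
    open ≡-Reasoning
    open +-*-Solver using (solve; _:*_; _:=_)

  penrose-expansion :
    penrose G (+ 2) ≡ (+ 2) ^ℤ isolated * ∑[ s ∈ allFuns nDarts ] ∑[ f ∈ allLabellings ] summand s f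
  penrose-expansion = begin
      penrose G (+ 2)
    ≡⟨ ∑-filter (λ s → isEdgeState s B.≟ true) (allFuns nDarts) weight ⟩
      ∑[ s ∈ allFuns nDarts ] (if does (isEdgeState s B.≟ true) then weight s else 0ℤ)
    ≡⟨ ∑-cong (allFuns nDarts) (λ s → per-state s (isEdgeState s) refl) ⟩
      ∑[ s ∈ allFuns nDarts ] ((+ 2) ^ℤ isolated * ∑[ f ∈ allLabellings ] summand s f)
    ≡⟨ sym (∑-*ˡ (allFuns nDarts) ((+ 2) ^ℤ isolated) (λ s → ∑[ f ∈ allLabellings ] summand s f)) ⟩
      (+ 2) ^ℤ isolated * ∑[ s ∈ allFuns nDarts ] ∑[ f ∈ allLabellings ] summand s f ∎
    where
    open ≡-Reasoning
    per-state : ∀ s b → isEdgeState s ≡ b →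
      (if does (isEdgeState s B.≟ true) then weight s else 0ℤ) ≡
      (+ 2) ^ℤ isolated * ∑[ f ∈ allLabellings ] summand s f
    per-state s true  e = trans (cong (λ t → if does (t B.≟ true) then weight s else 0ℤ) e) (weight-edgeState s e)
    per-state s false e = trans (cong (λ t → if does (t B.≟ true) then weight s else 0ℤ) e) (sym (trans
      (cong ((+ 2) ^ℤ isolated *_)
            (trans (∑-cong allLabellings λ f → summand-nonEdgeState s f e) (∑-zero allLabellings)))
      (ℤ.*-zeroʳ ((+ 2) ^ℤ isolated))))

  isFirstDart : Dart → Bool
  isFirstDart d = does (d <? α d)

  isFirstDart-α : ∀ d → isFirstDart (α d) ≡ not (isFirstDart d)
  isFirstDart-α d rewrite α-invol d with F.<-cmp d (α d)
  ... | tri< d<αd _ αd≮d = trans (dec-false (α d <? d) αd≮d) (cong not (sym (dec-true (d <? α d) d<αd)))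
  ... | tri≈ _ d≡αd _    = ⊥-elim (α-fpf d (sym d≡αd))
  ... | tri> d≮αd _ αd<d = trans (dec-true (α d <? d) αd<d) (cong not (sym (dec-false (d <? α d) d≮αd)))

  ⊕-α : ∀ e → ⊕ e ≡ ⊕ (e ∘ α)
  ⊕-α e = ⊕-permute e α-permutation

  crossingParity : (Dart → Bool) → Bool
  crossingParity s = ⊕ λ d → s d ∧ isFirstDart d

  crossingParity-edgeDifference : ∀ k → crossingParity (λ d → k d xor k (α d)) ≡ ⊕ k
  crossingParity-edgeDifference k = begin
      ⊕ (λ d → (k d xor k (α d)) ∧ isFirstDart d)
    ≡⟨ ⊕-cong (λ d → B.∧-distribʳ-xor (isFirstDart d) (k d) (k (α d))) ⟩
      ⊕ (λ d → (k d ∧ isFirstDart d) xor (k (α d) ∧ isFirstDart d))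
    ≡⟨ ⊕-distrib-xor (λ d → k d ∧ isFirstDart d) (λ d → k (α d) ∧ isFirstDart d) ⟩
      ⊕ (λ d → k d ∧ isFirstDart d) xor ⊕ (λ d → k (α d) ∧ isFirstDart d)
    ≡⟨ cong (⊕ (λ d → k d ∧ isFirstDart d) xor_) (trans (⊕-α (λ d → k (α d) ∧ isFirstDart d))
         (⊕-cong λ d → cong (λ t → k t ∧ isFirstDart (α d)) (α-invol d))) ⟩
      ⊕ (λ d → k d ∧ isFirstDart d) xor ⊕ (λ d → k d ∧ isFirstDart (α d))
    ≡⟨ sym (⊕-distrib-xor (λ d → k d ∧ isFirstDart d) (λ d → k d ∧ isFirstDart (α d))) ⟩
      ⊕ (λ d → (k d ∧ isFirstDart d) xor (k d ∧ isFirstDart (α d)))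
    ≡⟨ ⊕-cong (λ d → trans (sym (B.∧-distribˡ-xor (k d) (isFirstDart d) (isFirstDart (α d))))
                           (trans (cong (k d ∧_) (exactly-one-first d)) (B.∧-identityʳ (k d)))) ⟩
      ⊕ k ∎
    where
    open ≡-Reasoning
    exactly-one-first : ∀ d → isFirstDart d xor isFirstDart (α d) ≡ true
    exactly-one-first d = trans (cong (isFirstDart d xor_) (isFirstDart-α d)) (B.xor-inverseʳ (isFirstDart d))

  crossingSign≡sign-parity : ∀ s → crossingSign s ≡ sign (crossingParity s)
  crossingSign≡sign-parity s = trans (-1^length-filter (λ d → d <? α d) (λ d → s d B.≟ true) darts)
    (cong sign (trans (foldr-xor-tabulate nDarts (λ d → d) _)
                      (⊕-cong λ d → cong (_∧ isFirstDart d) (does-≟-true (s d)))))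

  crossingSign-cong : ∀ {s s′} → s ≗ s′ → crossingSign s ≡ crossingSign s′
  crossingSign-cong {s} {s′} eq = trans (crossingSign≡sign-parity s)
    (trans (cong sign (⊕-cong λ d → cong (_∧ isFirstDart d) (eq d))) (sym (crossingSign≡sign-parity s′)))

  isEdgeState-cong : ∀ {s s′} → s ≗ s′ → isEdgeState s ≡ isEdgeState s′
  isEdgeState-cong eq = all-cong _ _ darts λ d → cong₂ (λ a b → ⌊ a B.≟ b ⌋) (eq (α d)) (eq d)

  compatible-cong : ∀ {s s′} f → s ≗ s′ → compatible s f ≡ compatible s′ f
  compatible-cong f eq = respects-cong f λ { (d , b) z →
    cong (λ t → ⌊ z ≟H medialPartner (d , b) ⌋ ∨ ⌊ (d , b) ≟H medialPartner z ⌋ ∨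
                ⌊ z ≟H (α d , (if t then b else not b)) ⌋) (eq d) }

  summand-extensional : ∀ f → Extensional (λ s → summand s f)
  summand-extensional f eq = cong₂ (λ b v → if b then v else 0ℤ) (isEdgeState-cong eq)
    (cong₂ _*_ (crossingSign-cong eq) (cong 𝟙 (compatible-cong f eq)))

  MedialConstant : (HalfEdge → Bool) → Set
  MedialConstant f = ∀ d → f (d , true) ≡ f (σ⁺ d , false)

  SeparatesCorners : (HalfEdge → Bool) → Set
  SeparatesCorners f = ∀ d → f (d , true) ≢ f (d , false)

  medialConstant : (HalfEdge → Bool) → Bool
  medialConstant f = all (λ d → ⌊ f (d , true) B.≟ f (σ⁺ d , false) ⌋) darts

  separatesCorners : (HalfEdge → Bool) → Bool
  separatesCorners f = all (λ d → not ⌊ f (d , true) B.≟ f (d , false) ⌋) darts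

  ∑-summand-not-medialConstant : ∀ f → medialConstant f ≡ false → ∑[ s ∈ allFuns nDarts ] summand s f ≡ 0ℤ
  ∑-summand-not-medialConstant f nc with all-false _ darts nc
  ... | d , _ , jump = trans (∑-cong (allFuns nDarts) λ s → summand-incompatible s f λ const →
                               false≢true (trans (sym jump) (≟-complete B._≟_ (proj₁ (const (d , true))))))
                             (∑-zero (allFuns nDarts))

  -- When f agrees on the two half-edges at v_{d₀} that a black split would join, flipping the
  -- vertex state at v_{d₀} between crossing and white split preserves compatibility with f but
  -- changes the number of crossings by one.
  module EdgeFlip (f : HalfEdge → Bool) (d₀ : Dart) (f-same : f (d₀ , true) ≡ f (d₀ , false)) where

    flipEdge : (Dart → Bool) → Dart → Bool
    flipEdge s = updateAt (updateAt s (α d₀) not) d₀ not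

    onEdge : Dart → Bool
    onEdge x = ⌊ x F.≟ α d₀ ⌋ xor ⌊ x F.≟ d₀ ⌋

    flipEdge-xor : ∀ s x → flipEdge s x ≡ s x xor onEdge x
    flipEdge-xor s x = trans (updateAt-not _ d₀ x)
      (trans (cong (_xor ⌊ x F.≟ d₀ ⌋) (updateAt-not s (α d₀) x)) (B.xor-assoc (s x) _ _))

    onEdge-α : ∀ x → onEdge (α x) ≡ onEdge x
    onEdge-α x = trans
      (cong₂ _xor_ (trans (≟-involution F._≟_ α α-invol x (α d₀))
                          (cong (λ t → ⌊ x F.≟ t ⌋) (α-invol d₀)))
                   (≟-involution F._≟_ α α-invol x d₀))
      (B.xor-comm ⌊ x F.≟ d₀ ⌋ _)

    d₀≢αd₀ : d₀ ≢ α d₀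
    d₀≢αd₀ e = α-fpf d₀ (sym e)

    onEdge-d₀ : onEdge d₀ ≡ true
    onEdge-d₀ = cong₂ _xor_ (≟-false F._≟_ d₀≢αd₀) (≟-refl F._≟_ d₀)

    onEdge-αd₀ : onEdge (α d₀) ≡ true
    onEdge-αd₀ = trans (onEdge-α d₀) onEdge-d₀

    onEdge-other : ∀ x → x ≢ d₀ → x ≢ α d₀ → onEdge x ≡ false
    onEdge-other x x≢d₀ x≢αd₀ = cong₂ _xor_ (≟-false F._≟_ x≢αd₀) (≟-false F._≟_ x≢d₀)

    flipEdge-other : ∀ s x → x ≢ d₀ → x ≢ α d₀ → flipEdge s x ≡ s x
    flipEdge-other s x x≢d₀ x≢αd₀ =
      trans (flipEdge-xor s x) (trans (cong (s x xor_) (onEdge-other x x≢d₀ x≢αd₀)) (B.xor-identityʳ (s x)))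

    isEdgeState-flipEdge : ∀ s → isEdgeState (flipEdge s) ≡ isEdgeState s
    isEdgeState-flipEdge s = all-cong _ _ darts λ d → begin
        ⌊ flipEdge s (α d) B.≟ flipEdge s d ⌋
      ≡⟨ cong₂ (λ a b → ⌊ a B.≟ b ⌋) (flipEdge-xor s (α d)) (flipEdge-xor s d) ⟩
        ⌊ s (α d) xor onEdge (α d) B.≟ s d xor onEdge d ⌋
      ≡⟨ cong (λ t → ⌊ s (α d) xor t B.≟ s d xor onEdge d ⌋) (onEdge-α d) ⟩
        ⌊ s (α d) xor onEdge d B.≟ s d xor onEdge d ⌋
      ≡⟨ ≟-xor (s (α d)) (s d) (onEdge d) ⟩
        ⌊ s (α d) B.≟ s d ⌋ ∎
      where open ≡-Reasoning

    onEdge-true : ∀ x → onEdge x ≡ true → x ≡ d₀ ⊎ x ≡ α d₀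
    onEdge-true x on with x F.≟ d₀ | x F.≟ α d₀
    ... | yes x≡d₀ | _         = inj₁ x≡d₀
    ... | no _     | yes x≡αd₀ = inj₂ x≡αd₀
    ... | no _     | no _      = ⊥-elim (false≢true on)

    firstDartOfEdge : Σ Dart λ m → onEdge m ≡ true × isFirstDart m ≡ true ×
                                   (∀ x → x ≢ m → onEdge x ≡ true → isFirstDart x ≡ false)
    firstDartOfEdge with isFirstDart d₀ in first
    ... | true  = d₀ , onEdge-d₀ , first , λ x x≢d₀ on → other x x≢d₀ (onEdge-true x on)
      where
      other : ∀ x → x ≢ d₀ → x ≡ d₀ ⊎ x ≡ α d₀ → isFirstDart x ≡ false
      other x x≢d₀ (inj₁ x≡d₀) = ⊥-elim (x≢d₀ x≡d₀)
      other x x≢d₀ (inj₂ refl) = trans (isFirstDart-α d₀) (cong not first)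
    ... | false = α d₀ , onEdge-αd₀ , trans (isFirstDart-α d₀) (cong not first) ,
                  λ x x≢αd₀ on → other x x≢αd₀ (onEdge-true x on)
      where
      other : ∀ x → x ≢ α d₀ → x ≡ d₀ ⊎ x ≡ α d₀ → isFirstDart x ≡ false
      other x x≢αd₀ (inj₁ refl)  = first
      other x x≢αd₀ (inj₂ x≡αd₀) = ⊥-elim (x≢αd₀ x≡αd₀)

    crossingParity-flipEdge : ∀ s → crossingParity (flipEdge s) ≡ not (crossingParity s)
    crossingParity-flipEdge s with firstDartOfEdge
    ... | m , on-m , first-m , others = ⊕-flip nDarts m _ _ unchanged flipped
      where
      unchanged : ∀ x → x ≢ m → flipEdge s x ∧ isFirstDart x ≡ s x ∧ isFirstDart x
      unchanged x x≢m with onEdge x in on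
      ... | true  rewrite others x x≢m on = trans (B.∧-zeroʳ _) (sym (B.∧-zeroʳ _))
      ... | false = cong (_∧ isFirstDart x)
                      (trans (flipEdge-xor s x) (trans (cong (s x xor_) on) (B.xor-identityʳ (s x))))
      flipped : flipEdge s m ∧ isFirstDart m ≡ not (s m ∧ isFirstDart m)
      flipped rewrite first-m | flipEdge-xor s m | on-m =
        trans (B.∧-identityʳ _) (trans (B.xor-comm (s m) true) (cong not (sym (B.∧-identityʳ (s m)))))

    crossingSign-flipEdge : ∀ s → crossingSign (flipEdge s) ≡ - crossingSign s
    crossingSign-flipEdge s = begin
        crossingSign (flipEdge s)
      ≡⟨ crossingSign≡sign-parity (flipEdge s) ⟩
        sign (crossingParity (flipEdge s))
      ≡⟨ cong sign (crossingParity-flipEdge s) ⟩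
        sign (not (crossingParity s))
      ≡⟨ sign-not (crossingParity s) ⟩
        - sign (crossingParity s)
      ≡⟨ cong -_ (sym (crossingSign≡sign-parity s)) ⟩
        - crossingSign s ∎
      where open ≡-Reasoning

    αd₀-ends : ∀ s → ConstantAlong s f → ∀ b → f (α d₀ , b) ≡ f (d₀ , true)
    αd₀-ends s const = ends (s d₀) (proj₂ (const (d₀ , true))) (proj₂ (const (d₀ , false)))
      where
      ends : ∀ c → f (d₀ , true) ≡ f (α d₀ , (if c then true else false)) →
             f (d₀ , false) ≡ f (α d₀ , (if c then false else true)) → ∀ b → f (α d₀ , b) ≡ f (d₀ , true)
      ends true  p q true  = sym p
      ends true  p q false = trans (sym q) (sym f-same)
      ends false p q true  = trans (sym q) (sym f-same)
      ends false p q false = sym p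

    d₀-ends : ∀ b → f (d₀ , b) ≡ f (d₀ , true)
    d₀-ends true  = refl
    d₀-ends false = sym f-same

    constantAlong-transfer : ∀ s₁ s₂ → (∀ x → x ≢ d₀ → x ≢ α d₀ → s₁ x ≡ s₂ x) →
                             ConstantAlong s₁ f → ConstantAlong s₂ f
    constantAlong-transfer s₁ s₂ agree const (d , b) = proj₁ (const (d , b)) , along d b
      where
      along : ∀ d b → f (d , b) ≡ f (statePartner s₂ (d , b))
      along d b with d F.≟ d₀
      ... | yes refl = trans (d₀-ends b) (sym (αd₀-ends s₁ const _))
      ... | no d≢d₀ with d F.≟ α d₀
      ... | yes refl = trans (αd₀-ends s₁ const b)
        (sym (trans (cong (λ t → f (t , (if s₂ (α d₀) then b else not b))) (α-invol d₀)) (d₀-ends _)))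
      ... | no d≢αd₀ rewrite sym (agree d d≢d₀ d≢αd₀) = proj₂ (const (d , b))

    compatible-flipEdge : ∀ s → compatible (flipEdge s) f ≡ compatible s f
    compatible-flipEdge s = bool-ext
      (λ c → compatible-complete s f (constantAlong-transfer (flipEdge s) s (flipEdge-other s)
                                        (compatible-sound (flipEdge s) f c)))
      (λ c → compatible-complete (flipEdge s) f (constantAlong-transfer s (flipEdge s)
                (λ x x≢d₀ x≢αd₀ → sym (flipEdge-other s x x≢d₀ x≢αd₀)) (compatible-sound s f c)))

    summand-flipEdge : ∀ s → summand (flipEdge s) f ≡ - summand s f
    summand-flipEdge s rewrite isEdgeState-flipEdge s | crossingSign-flipEdge s | compatible-flipEdge s
      with isEdgeState s
    ... | true  = sym (ℤ.neg-distribˡ-* (crossingSign s) _)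
    ... | false = refl

    ∑-summand≡0 : ∑[ s ∈ allFuns nDarts ] summand s f ≡ 0ℤ
    ∑-summand≡0 = ≡-neg⇒≡0 (begin
        ∑[ s ∈ allFuns nDarts ] summand s f
      ≡⟨ ∑-allFuns-updateAt nDarts d₀ (λ s → summand s f) (summand-extensional f) ⟩
        ∑[ s ∈ allFuns nDarts ] summand (updateAt s d₀ not) f
      ≡⟨ ∑-allFuns-updateAt nDarts (α d₀) (λ s → summand (updateAt s d₀ not) f)
                              (summand-extensional f ∘ updateAt-≗ d₀ not) ⟩
        ∑[ s ∈ allFuns nDarts ] summand (flipEdge s) f
      ≡⟨ ∑-cong (allFuns nDarts) summand-flipEdge ⟩
        ∑[ s ∈ allFuns nDarts ] (- summand s f)
      ≡⟨ sym (∑-neg (allFuns nDarts) (λ s → summand s f)) ⟩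
        - ∑[ s ∈ allFuns nDarts ] summand s f ∎)
      where open ≡-Reasoning

  admissible : (HalfEdge → Bool) → Bool
  admissible f = medialConstant f ∧ separatesCorners f

  admissible-sound : ∀ f → admissible f ≡ true → MedialConstant f × SeparatesCorners f
  admissible-sound f e =
    (λ d → ≟-sound B._≟_ (all-elim _ darts (∧-elimˡ (medialConstant f) e) (∈-darts d))) ,
    (λ d same → false≢true (trans (sym (cong not (≟-complete B._≟_ same)))
                                  (all-elim _ darts (∧-elimʳ (medialConstant f) e) (∈-darts d))))

  admissible-complete : ∀ f → MedialConstant f → SeparatesCorners f → admissible f ≡ true
  admissible-complete f medial separates = ∧-intro
    (all-intro _ darts λ {d} _ → ≟-complete B._≟_ (medial d))
    (all-intro _ darts λ {d} _ → cong not (≟-false B._≟_ (separates d)))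

  module Checkerboard (col : Dart → Bool) (col-face : ∀ d → col (α (σ⁺ d)) ≡ col d)
                      (col-edge : ∀ d → col (α d) ≢ col d) where

    col-α : ∀ d → col (α d) ≡ not (col d)
    col-α d = ≢⇒≡not (col-edge d)

    col-σ : ∀ d → col (σ⁺ d) ≡ not (col d)
    col-σ d = ≢⇒≡not λ e → col-edge (σ⁺ d) (trans (col-face d) (sym e))

    col-σ⁻ : ∀ d → col (σ⁻ d) ≡ not (col d)
    col-σ⁻ d = trans (sym (B.not-involutive _))
                     (cong not (sym (trans (cong col (sym (σ⁺-σ⁻ d))) (col-σ (σ⁻ d)))))

    -- Corners alternate in colour around every vertex, so σ maps the darts whose corner is black
    -- bijectively onto those whose corner is white: every vertex has even degree.
    ⊕-rotation-invariant : ∀ k → (∀ d → k (σ⁺ d) ≡ k d) → ⊕ k ≡ false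
    ⊕-rotation-invariant k k-σ = begin
        ⊕ k
      ≡⟨ ⊕-cong (λ d → split (k d) (col d)) ⟩
        ⊕ (λ d → (k d ∧ col d) xor (k d ∧ not (col d)))
      ≡⟨ ⊕-distrib-xor (λ d → k d ∧ col d) (λ d → k d ∧ not (col d)) ⟩
        ⊕ (λ d → k d ∧ col d) xor ⊕ (λ d → k d ∧ not (col d))
      ≡⟨ cong (_xor ⊕ (λ d → k d ∧ not (col d)))
              (trans (⊕-permute (λ d → k d ∧ col d) σ) (⊕-cong λ d → cong₂ _∧_ (k-σ d) (col-σ d))) ⟩
        ⊕ (λ d → k d ∧ not (col d)) xor ⊕ (λ d → k d ∧ not (col d))
      ≡⟨ B.xor-same (⊕ (λ d → k d ∧ not (col d))) ⟩
        false ∎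
      where
      open ≡-Reasoning
      split : ∀ x c → x ≡ (x ∧ c) xor (x ∧ not c)
      split true  true  = refl
      split true  false = refl
      split false c     = refl

    vertexLabel : (HalfEdge → Bool) → Dart → Bool
    vertexLabel f d = f (d , true) xor col d

    module AdmissibleLabelling (f : HalfEdge → Bool) (medial : MedialConstant f)
                               (separates : SeparatesCorners f) where

      vertexLabel-σ : ∀ d → vertexLabel f (σ⁺ d) ≡ vertexLabel f d
      vertexLabel-σ d = trans
        (cong₂ _xor_ (trans (≢⇒≡not (separates (σ⁺ d))) (cong not (sym (medial d)))) (col-σ d))
        (B.xor-annihilates-not (f (d , true)) (col d))

      -- The only vertex state at v_d compatible with f: crossing iff f agrees on (d,true) and (α d,true).
      forcedState : Dart → Bool
      forcedState d = ⌊ f (d , true) B.≟ f (α d , true) ⌋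

      forcedState-α : ∀ d → forcedState (α d) ≡ forcedState d
      forcedState-α d = trans (cong (λ t → ⌊ f (α d , true) B.≟ f (t , true) ⌋) (α-invol d))
                              (≟-sym B._≟_ (f (α d , true)) (f (d , true)))

      constantAlong⇒forced : ∀ s → ConstantAlong s f → s ≗ forcedState
      constantAlong⇒forced s const d = forced (s d) (proj₂ (const (d , true)))
        where
        forced : ∀ c → f (d , true) ≡ f (α d , (if c then true else false)) → c ≡ forcedState d
        forced true  p = sym (≟-complete B._≟_ p)
        forced false p = sym (≟-false B._≟_ λ e → separates (α d) (trans (sym e) p))

      f-at : ∀ x b → f (x , b) ≡ (if b then f (x , true) else not (f (x , true)))
      f-at x true  = refl
      f-at x false = ≢⇒≡not (separates x ∘ sym)

      forced-along : ∀ s → s ≗ forcedState → ∀ d b → f (d , b) ≡ f (statePartner s (d , b))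
      forced-along s s≗ d b rewrite s≗ d =
        trans (f-at d b) (trans (select-≟ (f (d , true)) (f (α d , true)) b) (sym (f-at (α d) _)))

      forced⇒constantAlong : ∀ s → s ≗ forcedState → ConstantAlong s f
      forced⇒constantAlong s s≗ (d , true)  = medial d , forced-along s s≗ d true
      forced⇒constantAlong s s≗ (d , false) =
        sym (trans (medial (σ⁻ d)) (cong (λ t → f (t , false)) (σ⁺-σ⁻ d))) , forced-along s s≗ d false

      summand≡δ-forced : ∀ s → summand s f ≡ 𝟙 (s ≗ᵇ forcedState) * crossingSign s
      summand≡δ-forced s with s ≗ᵇ forcedState in eq
      ... | true  = trans (summand-edgeState s f edge)
                          (trans (cong (λ t → crossingSign s * 𝟙 t) compat)
                                 (trans (ℤ.*-identityʳ _) (sym (ℤ.*-identityˡ _))))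
        where
        s≗ : s ≗ forcedState
        s≗ = ≗ᵇ-sound s forcedState eq
        edge : isEdgeState s ≡ true
        edge = isEdgeState-complete s λ d → trans (s≗ (α d)) (trans (forcedState-α d) (sym (s≗ d)))
        compat : compatible s f ≡ true
        compat = compatible-complete s f (forced⇒constantAlong s s≗)
      ... | false = trans (summand-incompatible s f λ const →
                            false≢true (trans (sym eq) (≗ᵇ-complete s forcedState (constantAlong⇒forced s const))))
                          (sym (ℤ.*-zeroˡ (crossingSign s)))

      forcedState≡ : ∀ d → forcedState d ≡ vertexLabel f d xor vertexLabel f (α d)
      forcedState≡ d = begin
          ⌊ f (d , true) B.≟ f (α d , true) ⌋
        ≡⟨ cong₂ (λ a b → ⌊ a B.≟ b ⌋) (sym (xor-cancelʳ (f (d , true)) (col d)))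
                 (sym (trans (cong (vertexLabel f (α d) xor_) (sym (col-α d)))
                             (xor-cancelʳ (f (α d , true)) (col (α d))))) ⟩
          ⌊ vertexLabel f d xor col d B.≟ vertexLabel f (α d) xor not (col d) ⌋
        ≡⟨ ≟-xor-not (vertexLabel f d) (vertexLabel f (α d)) (col d) ⟩
          vertexLabel f d xor vertexLabel f (α d) ∎
        where open ≡-Reasoning

      crossingParity-forced : crossingParity forcedState ≡ false
      crossingParity-forced = begin
          crossingParity forcedState
        ≡⟨ ⊕-cong (λ d → cong (_∧ isFirstDart d) (forcedState≡ d)) ⟩
          crossingParity (λ d → vertexLabel f d xor vertexLabel f (α d))
        ≡⟨ crossingParity-edgeDifference (vertexLabel f) ⟩
          ⊕ (vertexLabel f)
        ≡⟨ ⊕-rotation-invariant (vertexLabel f) vertexLabel-σ ⟩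
          false ∎
        where open ≡-Reasoning

      ∑-summand≡1 : ∑[ s ∈ allFuns nDarts ] summand s f ≡ 1ℤ
      ∑-summand≡1 = begin
          ∑[ s ∈ allFuns nDarts ] summand s f
        ≡⟨ ∑-cong (allFuns nDarts) summand≡δ-forced ⟩
          ∑[ s ∈ allFuns nDarts ] (𝟙 (s ≗ᵇ forcedState) * crossingSign s)
        ≡⟨ ∑-allFuns-δ nDarts forcedState crossingSign crossingSign-cong ⟩
          crossingSign forcedState
        ≡⟨ crossingSign≡sign-parity forcedState ⟩
          sign (crossingParity forcedState)
        ≡⟨ cong sign crossingParity-forced ⟩
          1ℤ ∎
        where open ≡-Reasoning

    ∑-summand≡𝟙-admissible : ∀ f →
      ∑[ s ∈ allFuns nDarts ] summand s f ≡ 𝟙 (medialConstant f ∧ separatesCorners f)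
    ∑-summand≡𝟙-admissible f with medialConstant f in mc
    ... | false = ∑-summand-not-medialConstant f mc
    ... | true with separatesCorners f in sc
    ... | true  = AdmissibleLabelling.∑-summand≡1 f (proj₁ sound) (proj₂ sound)
      where
      sound : MedialConstant f × SeparatesCorners f
      sound = admissible-sound f (cong₂ _∧_ mc sc)
    ... | false with all-false _ darts sc
    ... | d₀ , _ , same = EdgeFlip.∑-summand≡0 f d₀ (≟-sound B._≟_ (B.not-injective {y = true} same))

    fromVertexLabel : (Dart → Bool) → HalfEdge → Bool
    fromVertexLabel k (d , true)  = k d xor col d
    fromVertexLabel k (d , false) = k (σ⁻ d) xor col (σ⁻ d)

    open Labellings using (labellings; agreeOn; agreeOn-sound; agreeOn-complete; ∑-labellings-agreeOn)

    isVertexLabelOf : (Dart → Bool) → (HalfEdge → Bool) → Bool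
    isVertexLabelOf k f = agreeOn F._≟_ darts k (vertexLabel f)

    isInducedBy : (HalfEdge → Bool) → (Dart → Bool) → Bool
    isInducedBy f k = agreeOn _≟H_ halfEdges f (fromVertexLabel k)

    admissible-correspondence : ∀ f k →
      (admissible f ∧ isVertexLabelOf k f) ≡ (respectsᴰ rotationAdj k ∧ isInducedBy f k)
    admissible-correspondence f k = bool-ext to from
      where
      to : admissible f ∧ isVertexLabelOf k f ≡ true → respectsᴰ rotationAdj k ∧ isInducedBy f k ≡ true
      to e = ∧-intro (respects-rotation-complete k k-σ)
                     (agreeOn-complete _≟H_ halfEdges f (fromVertexLabel k) f≗)
        where
        medial-separates : MedialConstant f × SeparatesCorners f
        medial-separates = admissible-sound f (∧-elimˡ (admissible f) e)
        open AdmissibleLabelling f (proj₁ medial-separates) (proj₂ medial-separates) using (vertexLabel-σ)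
        k≗ : ∀ d → k d ≡ vertexLabel f d
        k≗ d = agreeOn-sound F._≟_ darts k (vertexLabel f) (∧-elimʳ (admissible f) e) (∈-darts d)
        k-σ : ∀ d → k (σ⁺ d) ≡ k d
        k-σ d = trans (k≗ (σ⁺ d)) (trans (vertexLabel-σ d) (sym (k≗ d)))
        f-true : ∀ d → f (d , true) ≡ k d xor col d
        f-true d = sym (trans (cong (_xor col d) (k≗ d)) (xor-cancelʳ (f (d , true)) (col d)))
        f≗ : ∀ h → f h ≡ fromVertexLabel k h
        f≗ (d , true)  = f-true d
        f≗ (d , false) = trans
          (sym (trans (proj₁ medial-separates (σ⁻ d)) (cong (λ t → f (t , false)) (σ⁺-σ⁻ d))))
          (f-true (σ⁻ d))
      from : respectsᴰ rotationAdj k ∧ isInducedBy f k ≡ true → admissible f ∧ isVertexLabelOf k f ≡ true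
      from e = ∧-intro (admissible-complete f medial separates)
        (agreeOn-complete F._≟_ darts k (vertexLabel f) λ d →
          sym (trans (cong (_xor col d) (f≗ (d , true))) (xor-cancelʳ (k d) (col d))))
        where
        k-σ : ∀ d → k (σ⁺ d) ≡ k d
        k-σ = respects-rotation-sound k (∧-elimˡ (respectsᴰ rotationAdj k) e)
        f≗ : ∀ h → f h ≡ fromVertexLabel k h
        f≗ h = agreeOn-sound _≟H_ halfEdges f (fromVertexLabel k) (∧-elimʳ (respectsᴰ rotationAdj k) e)
                             (∈-halfEdges h)
        k-σ⁻ : ∀ d → k (σ⁻ d) ≡ k d
        k-σ⁻ d = trans (sym (k-σ (σ⁻ d))) (cong k (σ⁺-σ⁻ d))
        medial : MedialConstant f
        medial d = trans (f≗ (d , true))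
                         (sym (trans (f≗ (σ⁺ d , false)) (cong (λ t → k t xor col t) (σ⁻-σ⁺ d))))
        separates : SeparatesCorners f
        separates d same = B.not-¬ refl (begin
            k d xor col d                 ≡⟨ sym (f≗ (d , true)) ⟩
            f (d , true)                  ≡⟨ same ⟩
            f (d , false)                 ≡⟨ f≗ (d , false) ⟩
            k (σ⁻ d) xor col (σ⁻ d)       ≡⟨ cong₂ _xor_ (k-σ⁻ d) (col-σ⁻ d) ⟩
            k d xor not (col d)           ≡⟨ sym (B.not-distribʳ-xor (k d) (col d)) ⟩
            not (k d xor col d)           ∎)
          where open ≡-Reasoning

    ∑-admissible≡2^components :
      ∑[ f ∈ allLabellings ] 𝟙 (admissible f) ≡ + (2 ^ Components.components F._≟_ darts rotationAdj)
    ∑-admissible≡2^components = begin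
        ∑[ f ∈ allLabellings ] 𝟙 (admissible f)
      ≡⟨ ∑-cong allLabellings (λ f → sym (∑-𝟙-∧-δ vertexLabellings (admissible f) (λ k → isVertexLabelOf k f)
                                   (∑-labellings-agreeOn F._≟_ _ darts (vertexLabel f) (allFin⁺ nDarts)))) ⟩
        ∑[ f ∈ allLabellings ] ∑[ k ∈ vertexLabellings ] 𝟙 (admissible f ∧ isVertexLabelOf k f)
      ≡⟨ ∑-cong allLabellings (λ f → ∑-cong vertexLabellings λ k → cong 𝟙 (admissible-correspondence f k)) ⟩
        ∑[ f ∈ allLabellings ] ∑[ k ∈ vertexLabellings ] 𝟙 (respectsᴰ rotationAdj k ∧ isInducedBy f k)
      ≡⟨ ∑-swap allLabellings vertexLabellings _ ⟩
        ∑[ k ∈ vertexLabellings ] ∑[ f ∈ allLabellings ] 𝟙 (respectsᴰ rotationAdj k ∧ isInducedBy f k)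
      ≡⟨ ∑-cong vertexLabellings (λ k → ∑-𝟙-∧-δ allLabellings (respectsᴰ rotationAdj k) (λ f → isInducedBy f k)
                                   (∑-labellings-agreeOn _≟H_ _ halfEdges (fromVertexLabel k) halfEdges-unique)) ⟩
        ∑[ k ∈ vertexLabellings ] 𝟙 (respectsᴰ rotationAdj k)
      ≡⟨ Vertices.∑-respects≡2^components ⟩
        + (2 ^ Components.components F._≟_ darts rotationAdj) ∎
      where
      open ≡-Reasoning
      vertexLabellings : List (Dart → Bool)
      vertexLabellings = labellings F._≟_ (λ _ → false) darts

proposition6p3 : (G : OrientableEmbeddedGraph) →
    OrientableEmbeddedGraph.CheckerboardColourable G →
    penrose G (+ 2) ≡ + (2 ^ OrientableEmbeddedGraph.numVertices G)
proposition6p3 G (col , col-face , col-edge) = begin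
    penrose G (+ 2)
  ≡⟨ penrose-expansion ⟩
    2^isolated * ∑[ s ∈ allFuns nDarts ] ∑[ f ∈ allLabellings ] summand s f
  ≡⟨ cong (2^isolated *_) (∑-swap (allFuns nDarts) allLabellings summand) ⟩
    2^isolated * ∑[ f ∈ allLabellings ] ∑[ s ∈ allFuns nDarts ] summand s f
  ≡⟨ cong (2^isolated *_) (∑-cong allLabellings ∑-summand≡𝟙-admissible) ⟩
    2^isolated * ∑[ f ∈ allLabellings ] 𝟙 (admissible f)
  ≡⟨ cong (2^isolated *_) (trans ∑-admissible≡2^components (sym (+-^ 2 vertexComponents))) ⟩
    2^isolated * (+ 2) ^ℤ vertexComponents
  ≡⟨ sym (ℤ.^-distribˡ-+-* (+ 2) isolated vertexComponents) ⟩
    (+ 2) ^ℤ numVertices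
  ≡⟨ +-^ 2 numVertices ⟩
    + (2 ^ numVertices) ∎
  where
  open ≡-Reasoning
  open OrientableEmbeddedGraph G
  open PenroseAtTwo G
  open Checkerboard col col-face col-edge
  2^isolated : ℤ
  2^isolated = (+ 2) ^ℤ isolated
  vertexComponents : ℕ
  vertexComponents = Components.components F._≟_ darts rotationAdj
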